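{- Let $G$ be a finite non-abelian nilpotent group such that $|G|$ has at least three distinct prime divisors. Then there is no graph $\Gamma$ such that $\mathcal{P}^{**}(G)=L(\Gamma)$.
   Context: For a finite group $G$, the power graph $\mathcal{P}(G)$ is the simple graph with vertex set $G$ in which two distinct vertices $u,v$ are adjacent iff $u^m=v$ or $v^n=u$ for some positive integers $m,n$. The proper power graph $\mathcal{P}^{**}(G)$ is obtained from $\mathcal{P}(G)$ by deleting all dominating vertices (vertices adjacent to all other vertices). $L(\Gamma)$ is the line graph of $\Gamma$: vertices are edges of $\Gamma$, adjacent iff they share an endpoint. -}

module Defs where

open import Data.Nat as ℕ using (ℕ; zero; suc; _≤_)
open import Data.Nat.Divisibility using (_∣_)
open import Data.Nat.Primality using (Prime)
open import Data.Fin using (Fin; toℕ)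
open import Data.Product using (Σ; ∃; ∃-syntax; _×_; _,_; proj₁; proj₂)
open import Data.Sum using (_⊎_)
open import Relation.Nullary using (¬_)
open import Relation.Binary.PropositionalEquality using (_≡_; _≢_)

-- Finite groups: a group whose carrier is Fin n (every finite group of
-- order n is isomorphic to one of these).

record FinGroup : Set where
  infixl 7 _·_
  field
    n     : ℕ
    _·_   : Fin n → Fin n → Fin n
    e     : Fin n
    inv   : Fin n → Fin n
    assoc : ∀ x y z → (x · y) · z ≡ x · (y · z)
    idˡ   : ∀ x → e · x ≡ x
    idʳ   : ∀ x → x · e ≡ x
    invˡ  : ∀ x → inv x · x ≡ e
    invʳ  : ∀ x → x · inv x ≡ e

module _ (G : FinGroup) where
  open FinGroup G

  Elt : Set
  Elt = Fin n

  order : ℕ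
  order = n

  pow : Elt → ℕ → Elt
  pow x zero    = e
  pow x (suc m) = x · pow x m

  NonAbelian : Set
  NonAbelian = ¬ (∀ x y → x · y ≡ y · x)

  UpperCentral : ℕ → Elt → Set
  UpperCentral zero    x = x ≡ e
  UpperCentral (suc i) x = ∀ g → UpperCentral i (x · g · inv x · inv g)

  Nilpotent : Set
  Nilpotent = ∃[ c ] (∀ x → UpperCentral c x)

  PowerAdj : Elt → Elt → Set
  PowerAdj u v = u ≢ v ×
    ((∃[ m ] (1 ≤ m × pow u m ≡ v)) ⊎ (∃[ m ] (1 ≤ m × pow v m ≡ u)))

  Dominating : Elt → Set
  Dominating u = ∀ v → v ≢ u → PowerAdj u v

  PPVertex : Set
  PPVertex = Σ Elt (λ u → ¬ Dominating u)

  PPAdj : PPVertex → PPVertex → Set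
  PPAdj u v = PowerAdj (proj₁ u) (proj₁ v)

AtLeastThreePrimeDivisors : ℕ → Set
AtLeastThreePrimeDivisors m =
  ∃[ p ] ∃[ q ] ∃[ r ]
    (Prime p × Prime q × Prime r × p ≢ q × q ≢ r × p ≢ r × p ∣ m × q ∣ m × r ∣ m)

record SimpleGraph : Set₁ where
  field
    k      : ℕ
    Adj    : Fin k → Fin k → Set
    sym    : ∀ {i j} → Adj i j → Adj j i
    irrefl : ∀ {i} → ¬ Adj i i

module _ (Γ : SimpleGraph) where
  open SimpleGraph Γ

  -- an edge {i,j} is represented canonically by (i , j) with i < j
  Edge : Set
  Edge = Σ (Fin k × Fin k) (λ p → (toℕ (proj₁ p) ℕ.< toℕ (proj₂ p)) × Adj (proj₁ p) (proj₂ p))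

  LineAdj : Edge → Edge → Set
  LineAdj ((i , j) , _) ((i' , j') , _) =
    (i , j) ≢ (i' , j') × (i ≡ i' ⊎ i ≡ j' ⊎ j ≡ i' ⊎ j ≡ j')

-- Graph isomorphism P**(G) ≅ L(Γ). Vertices are compared by their
-- underlying element / endpoint pair (the proof components are irrelevant).

record PPIsoLine (G : FinGroup) (Γ : SimpleGraph) : Set where
  field
    to       : PPVertex G → Edge Γ
    from     : Edge Γ → PPVertex G
    from∘to  : ∀ v → proj₁ (from (to v)) ≡ proj₁ v
    to∘from  : ∀ d → proj₁ (to (from d)) ≡ proj₁ d
    adj-to   : ∀ u v → PPAdj G u v → LineAdj Γ (to u) (to v)
    adj-from : ∀ u v → LineAdj Γ (to u) (to v) → PPAdj G u v

-- In a nilpotent group, elements of coprime orders commute: their commutator is central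
-- modulo each term of the upper central series, hence lies in the term below. Splitting a
-- non-commuting pair into prime-power parts therefore yields a non-commuting pair a, a′ with
-- a common exponent A prime to two of the three primes, say s and t. Cauchy's theorem (by
-- McKay's count of q-tuples with product e) gives b of order s and c of order t. In 𝒫**(G)
-- the vertex b is adjacent to ab, a′b and cb, and these are pairwise non-adjacent and
-- separated by a neighbour of one of them. In a line graph two of these three edges would
-- share an endpoint of the edge b, so no such graph exists.

module Submission where

open import Defs
open import Level using (0ℓ)
open import Algebra.Bundles using (Group)
import Algebra.Properties.Group as GroupProperties
open import Data.Bool.Base using (Bool; true; false; not)
import Data.Bool.Properties as Bool
open import Data.Empty using (⊥)
open import Data.Fin.Base using (Fin; toℕ; fromℕ<)
import Data.Fin.Properties as Fin
open import Data.List.Base using (List; []; _∷_; _++_; [_]; foldr; length; replicate)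
import Data.List.Properties as List
open import Data.Nat.Base as ℕ
  using (ℕ; zero; suc; _+_; _*_; _∸_; _<_; z<s; NonZero; >-nonZero; nonTrivial⇒n>1; nonTrivial⇒≢1)
import Data.Nat.Properties as ℕ
open import Data.Nat.Coprimality as Coprimality using (Coprime; coprime-Bézout; coprime-divisor; prime⇒coprime)
open import Data.Nat.DivMod using (_%_; _/_; m≡m%n+[m/n]*n; m%n<n)
open import Data.Nat.Divisibility
  using (_∣_; _∣?_; divides; _∣0; ∣-refl; ∣-trans; ∣1⇒≡1; m∣m*n; n∣m*n; ∣m⇒∣m*n; ∣m∣n⇒∣m+n; ∣m+n∣m⇒∣n)
open import Data.Nat.GCD using (module Bézout)
open import Data.Nat.GeneralisedArithmetic using (iterate)
open import Data.Nat.Induction using (<-wellFounded)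
open import Data.Nat.Primality using (Prime; prime⇒irreducible; prime⇒nonTrivial; prime⇒nonZero; euclidsLemma)
open import Data.Nat.Tactic.RingSolver using (solve-∀)
open import Data.Product using (∃; ∃₂; _×_; _,_; proj₁; proj₂)
import Data.Product.Properties as Product
open import Data.Sum as Sum using (_⊎_; inj₁; inj₂)
open import Data.Vec.Base using (Vec; lookup)
open import Function.Base using (_∘_)
open import Induction.WellFounded using (Acc; acc)
open import Relation.Binary.Bundles using (Setoid)
open import Relation.Binary.Definitions using (DecidableEquality; tri<; tri≈; tri>)
open import Relation.Binary.PropositionalEquality hiding ([_])
import Relation.Binary.Reasoning.Setoid as SetoidReasoning
import Relation.Binary.Reflection as Reflection
open import Relation.Nullary using (¬_; Dec; yes; no; contradiction)
open import Relation.Nullary.Decidable using (_×-dec_; ¬?)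
open import Relation.Unary using (Pred; Decidable)
open import Algebra.Properties.CommutativeMonoid.Sum ℕ.+-0-commutativeMonoid
  using (sum; sum-syntax; sum-cong-≗; ∑-distrib-+; ∑-comm)

-- Arithmetic

1<prime : ∀ {p} → Prime p → 1 < p
1<prime {p} pp = nonTrivial⇒n>1 p ⦃ prime⇒nonTrivial pp ⦄

0<prime : ∀ {p} → Prime p → 0 < p
0<prime pp = ℕ.<-trans z<s (1<prime pp)

prime∤1 : ∀ {p} → Prime p → ¬ p ∣ 1
prime∤1 pp p∣1 = nonTrivial⇒≢1 ⦃ prime⇒nonTrivial pp ⦄ (∣1⇒≡1 p∣1)

prime∤prime : ∀ {p q} → Prime p → Prime q → p ≢ q → ¬ p ∣ q
prime∤prime pp pq p≢q p∣q with prime⇒irreducible pq p∣q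
... | inj₁ refl = prime∤1 pp ∣-refl
... | inj₂ p≡q  = p≢q p≡q

prime∤* : ∀ {p m n} → Prime p → ¬ p ∣ m → ¬ p ∣ n → ¬ p ∣ m * n
prime∤* {m = m} {n} pp p∤m p∤n p∣mn with euclidsLemma m n pp p∣mn
... | inj₁ p∣m = p∤m p∣m
... | inj₂ p∣n = p∤n p∣n

prime∤^ : ∀ {p m} → Prime p → ¬ p ∣ m → ∀ i → ¬ p ∣ m ℕ.^ i
prime∤^ pp p∤m zero    = prime∤1 pp
prime∤^ pp p∤m (suc i) = prime∤* pp p∤m (prime∤^ pp p∤m i)

prime∤⇒coprime : ∀ {p m} → Prime p → ¬ p ∣ m → Coprime m p
prime∤⇒coprime pp p∤m (d∣m , d∣p) with prime⇒irreducible pp d∣p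
... | inj₁ d≡1 = d≡1
... | inj₂ refl = contradiction d∣m p∤m

coprime-*ˡ : ∀ {a b c} → Coprime a c → Coprime b c → Coprime (a * b) c
coprime-*ˡ a⊥c b⊥c (d∣ab , d∣c) = b⊥c (coprime-divisor d⊥a d∣ab , d∣c)
  where
  d⊥a : Coprime _ _
  d⊥a (k∣d , k∣a) = a⊥c (k∣a , ∣-trans k∣d d∣c)

coprime-^ˡ : ∀ {a c} → Coprime a c → ∀ i → Coprime (a ℕ.^ i) c
coprime-^ˡ a⊥c zero    (d∣1 , _) = ∣1⇒≡1 d∣1
coprime-^ˡ a⊥c (suc i)           = coprime-*ˡ a⊥c (coprime-^ˡ a⊥c i)

-- Bézout's identity v i + u j ≡ 1 (mod u v), stated without subtraction.
record BézoutMod (u v : ℕ) : Set where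
  field
    i j c  : ℕ
    bézout : v * i + u * j ≡ 1 + c * (u * v)

coprime⇒bézoutMod : ∀ {u v} → Coprime u v → 0 < u → 0 < v → BézoutMod u v
coprime⇒bézoutMod {suc u} {v} u⊥v _ _ with coprime-Bézout u⊥v
... | Bézout.+- x y 1+yv≡xu = record { i = y * u ; j = x ; c = y ; bézout = begin
  v * (y * u) + suc u * x   ≡⟨ cong (v * (y * u) +_) (ℕ.*-comm (suc u) x) ⟩
  v * (y * u) + x * suc u   ≡⟨ cong (v * (y * u) +_) 1+yv≡xu ⟨
  v * (y * u) + (1 + y * v) ≡⟨ rearrange v y u ⟩
  1 + y * (suc u * v)       ∎ }
  where
  open ≡-Reasoning
  rearrange : ∀ v y u → v * (y * u) + (1 + y * v) ≡ 1 + y * (suc u * v)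
  rearrange = solve-∀
coprime⇒bézoutMod {u} {suc v} u⊥v _ _ | Bézout.-+ x y 1+xu≡yv = record { i = y ; j = x * v ; c = x ; bézout = begin
  suc v * y + u * (x * v)   ≡⟨ cong (_+ u * (x * v)) (ℕ.*-comm (suc v) y) ⟩
  y * suc v + u * (x * v)   ≡⟨ cong (_+ u * (x * v)) 1+xu≡yv ⟨
  (1 + x * u) + u * (x * v) ≡⟨ rearrange u x v ⟩
  1 + x * (u * suc v)       ∎ }
  where
  open ≡-Reasoning
  rearrange : ∀ u x v → (1 + x * u) + u * (x * v) ≡ 1 + x * (u * suc v)
  rearrange = solve-∀

factor-out-prime : ∀ {p} → Prime p → ∀ m → 0 < m → ∃₂ λ i w → m ≡ p ℕ.^ i * w × ¬ p ∣ w
factor-out-prime {p} pp m 0<m = go m 0<m (<-wellFounded m)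
  where
  go : ∀ m → 0 < m → Acc _<_ m → ∃₂ λ i w → m ≡ p ℕ.^ i * w × ¬ p ∣ w
  go m 0<m (acc rec) with p ∣? m
  ... | no p∤m = 0 , m , sym (ℕ.+-identityʳ m) , p∤m
  ... | yes (divides zero refl) = contradiction 0<m (ℕ.<-irrefl refl)
  ... | yes (divides k@(suc _) refl) with go k z<s (rec (ℕ.m<m*n k p (1<prime pp)))
  ...   | i , w , k≡pⁱw , p∤w = suc i , w , trans (cong (_* p) k≡pⁱw) (rearrange (p ℕ.^ i) w p) , p∤w
    where
    rearrange : ∀ a w p → a * w * p ≡ p * a * w
    rearrange = solve-∀

∣⇒∣^ : ∀ {d m k} → d ∣ m → 0 < k → d ∣ m ℕ.^ k
∣⇒∣^ {m = m} {suc k} d∣m _ = ∣m⇒∣m*n (m ℕ.^ k) d∣m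

*-positiveʳ : ∀ m {n} → 0 < m * n → 0 < n
*-positiveʳ m {zero}  0<m*0 = contradiction (ℕ.*-zeroʳ m) (ℕ.>⇒≢ 0<m*0)
*-positiveʳ m {suc n} _     = z<s

0<prime^ : ∀ {p} → Prime p → ∀ i → 0 < p ℕ.^ i
0<prime^ {p} pp i = ℕ.m^n>0 p ⦃ prime⇒nonZero pp ⦄ i

prime∤prime^ : ∀ {p q} → Prime p → Prime q → p ≢ q → ∀ i → ¬ p ∣ q ℕ.^ i
prime∤prime^ pp pq p≢q = prime∤^ pp (prime∤prime pp pq p≢q)

-- Groups

asGroup : FinGroup → Group 0ℓ 0ℓ
asGroup G = record
  { isGroup = record
    { isMonoid = record
      { isSemigroup = record
        { isMagma = record { isEquivalence = isEquivalence ; ∙-cong = cong₂ _·_ }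
        ; assoc = assoc }
      ; identity = idˡ , idʳ }
    ; inverse = invˡ , invʳ
    ; ⁻¹-cong = cong inv } }
  where open FinGroup G

module GroupSolver (G : FinGroup) where
  open FinGroup G
  open GroupProperties (asGroup G)

  infixl 7 _⊗_
  infix  8 _⁻

  data Expr (k : ℕ) : Set where
    var : Fin k → Expr k
    ι   : Expr k
    _⊗_ : Expr k → Expr k → Expr k
    _⁻  : Expr k → Expr k

  ⟦_⟧ : ∀ {k} → Expr k → Vec (Elt G) k → Elt G
  ⟦ var i ⟧ ρ = lookup ρ i
  ⟦ ι     ⟧ ρ = e
  ⟦ a ⊗ b ⟧ ρ = ⟦ a ⟧ ρ · ⟦ b ⟧ ρ
  ⟦ a ⁻   ⟧ ρ = inv (⟦ a ⟧ ρ)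

  -- A letter (i , true) stands for the inverse of the variable i.
  Letter : ℕ → Set
  Letter k = Fin k × Bool

  _≟ₗ_ : ∀ {k} → DecidableEquality (Letter k)
  _≟ₗ_ = Product.≡-dec Fin._≟_ Bool._≟_

  flip : ∀ {k} → Letter k → Letter k
  flip (i , b) = i , not b

  push : ∀ {k} → Letter k → List (Letter k) → List (Letter k)
  push l []       = l ∷ []
  push l (l′ ∷ w) with l′ ≟ₗ flip l
  ... | yes _ = w
  ... | no  _ = l ∷ l′ ∷ w

  _·ʷ_ : ∀ {k} → List (Letter k) → List (Letter k) → List (Letter k)
  []      ·ʷ w = w
  (l ∷ v) ·ʷ w = push l (v ·ʷ w)

  inverse : ∀ {k} → List (Letter k) → List (Letter k)
  inverse []      = []
  inverse (l ∷ w) = inverse w ·ʷ (flip l ∷ [])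

  normalise : ∀ {k} → Expr k → List (Letter k)
  normalise (var i) = (i , false) ∷ []
  normalise ι       = []
  normalise (a ⊗ b) = normalise a ·ʷ normalise b
  normalise (a ⁻)   = inverse (normalise a)

  module _ {k} (ρ : Vec (Elt G) k) where
    ⟦_⟧ₗ : Letter k → Elt G
    ⟦ i , false ⟧ₗ = lookup ρ i
    ⟦ i , true  ⟧ₗ = inv (lookup ρ i)

    ⟦_⟧ʷ : List (Letter k) → Elt G
    ⟦ []    ⟧ʷ = e
    ⟦ l ∷ w ⟧ʷ = ⟦ l ⟧ₗ · ⟦ w ⟧ʷ

    ⟦flip⟧ : ∀ l → ⟦ flip l ⟧ₗ ≡ inv ⟦ l ⟧ₗ
    ⟦flip⟧ (i , false) = refl
    ⟦flip⟧ (i , true)  = sym (⁻¹-involutive _)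

    cancel-flip : ∀ l x → ⟦ l ⟧ₗ · (⟦ flip l ⟧ₗ · x) ≡ x
    cancel-flip l x = trans (cong (λ y → ⟦ l ⟧ₗ · (y · x)) (⟦flip⟧ l)) (\\-leftDividesˡ _ x)

    push-correct : ∀ l w → ⟦ push l w ⟧ʷ ≡ ⟦ l ⟧ₗ · ⟦ w ⟧ʷ
    push-correct l []       = refl
    push-correct l (l′ ∷ w) with l′ ≟ₗ flip l
    ... | yes refl = sym (cancel-flip l ⟦ w ⟧ʷ)
    ... | no  _    = refl

    ·ʷ-correct : ∀ v w → ⟦ v ·ʷ w ⟧ʷ ≡ ⟦ v ⟧ʷ · ⟦ w ⟧ʷ
    ·ʷ-correct []      w = sym (idˡ _)
    ·ʷ-correct (l ∷ v) w = begin
      ⟦ push l (v ·ʷ w) ⟧ʷ     ≡⟨ push-correct l (v ·ʷ w) ⟩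
      ⟦ l ⟧ₗ · ⟦ v ·ʷ w ⟧ʷ      ≡⟨ cong (⟦ l ⟧ₗ ·_) (·ʷ-correct v w) ⟩
      ⟦ l ⟧ₗ · (⟦ v ⟧ʷ · ⟦ w ⟧ʷ) ≡⟨ assoc _ _ _ ⟨
      ⟦ l ⟧ₗ · ⟦ v ⟧ʷ · ⟦ w ⟧ʷ   ∎
      where open ≡-Reasoning

    inverse-correct : ∀ w → ⟦ inverse w ⟧ʷ ≡ inv ⟦ w ⟧ʷ
    inverse-correct []      = sym (ε⁻¹≈ε)
    inverse-correct (l ∷ w) = begin
      ⟦ inverse w ·ʷ (flip l ∷ []) ⟧ʷ  ≡⟨ ·ʷ-correct (inverse w) (flip l ∷ []) ⟩
      ⟦ inverse w ⟧ʷ · (⟦ flip l ⟧ₗ · e) ≡⟨ cong₂ _·_ (inverse-correct w) (trans (idʳ _) (⟦flip⟧ l)) ⟩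
      inv ⟦ w ⟧ʷ · inv ⟦ l ⟧ₗ            ≡⟨ ⁻¹-anti-homo-∙ _ _ ⟨
      inv (⟦ l ⟧ₗ · ⟦ w ⟧ʷ)              ∎
      where open ≡-Reasoning

  correct : ∀ {k} (a : Expr k) ρ → ⟦_⟧ʷ ρ (normalise a) ≡ ⟦ a ⟧ ρ
  correct (var i) ρ = idʳ _
  correct ι       ρ = refl
  correct (a ⊗ b) ρ = trans (·ʷ-correct ρ (normalise a) (normalise b)) (cong₂ _·_ (correct a ρ) (correct b ρ))
  correct (a ⁻)   ρ = trans (inverse-correct ρ (normalise a)) (cong inv (correct a ρ))

  open Reflection (setoid (Elt G)) var ⟦_⟧ (λ a ρ → ⟦_⟧ʷ ρ (normalise a)) correct public
    using (solve; _⊜_)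


module GroupTheory (G : FinGroup) where
  open FinGroup G public
  open GroupProperties (asGroup G) public
    using (∙-cancelʳ; ε⁻¹≈ε; inverseˡ-unique; inverseʳ-unique; identityˡ-unique; identityʳ-unique)
  open GroupSolver G public using (solve; _⊜_; _⊗_; _⁻; ι)

  infixr 8 _^_
  _^_ : Elt G → ℕ → Elt G
  _^_ = pow G

  Commute : Elt G → Elt G → Set
  Commute x y = x · y ≡ y · x

  ^-+ : ∀ x a b → x ^ (a + b) ≡ x ^ a · x ^ b
  ^-+ x zero    b = sym (idˡ _)
  ^-+ x (suc a) b = trans (cong (x ·_) (^-+ x a b)) (sym (assoc _ _ _))

  ^-*-assoc : ∀ x a b → (x ^ a) ^ b ≡ x ^ (a * b)
  ^-*-assoc x a b = trans (go b) (cong (x ^_) (ℕ.*-comm b a))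
    where
    go : ∀ b → (x ^ a) ^ b ≡ x ^ (b * a)
    go zero    = refl
    go (suc b) = trans (cong (x ^ a ·_) (go b)) (sym (^-+ x a (b * a)))

  e^ : ∀ k → e ^ k ≡ e
  e^ zero    = refl
  e^ (suc k) = trans (idˡ _) (e^ k)

  ^-∣ : ∀ {x} u {m} → u ∣ m → x ^ u ≡ e → x ^ m ≡ e
  ^-∣ {x} u (divides q refl) xᵘ≡e = begin
    x ^ (q * u)  ≡⟨ cong (x ^_) (ℕ.*-comm q u) ⟩
    x ^ (u * q)  ≡⟨ ^-*-assoc x u q ⟨
    (x ^ u) ^ q  ≡⟨ cong (_^ q) xᵘ≡e ⟩
    e ^ q        ≡⟨ e^ q ⟩
    e            ∎
    where open ≡-Reasoning

  commute-^ˡ : ∀ {x y} i → Commute x y → Commute (x ^ i) y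
  commute-^ˡ {x} {y} zero    xy≡yx = trans (idˡ y) (sym (idʳ y))
  commute-^ˡ {x} {y} (suc i) xy≡yx = begin
    x · x ^ i · y    ≡⟨ assoc _ _ _ ⟩
    x · (x ^ i · y)  ≡⟨ cong (x ·_) (commute-^ˡ i xy≡yx) ⟩
    x · (y · x ^ i)  ≡⟨ assoc _ _ _ ⟨
    x · y · x ^ i    ≡⟨ cong (_· x ^ i) xy≡yx ⟩
    y · x · x ^ i    ≡⟨ assoc _ _ _ ⟩
    y · (x · x ^ i)  ∎
    where open ≡-Reasoning

  commute-^ : ∀ {x y} i j → Commute x y → Commute (x ^ i) (y ^ j)
  commute-^ i j xy≡yx = sym (commute-^ˡ j (sym (commute-^ˡ i xy≡yx)))

  commute-self-^ : ∀ x i → Commute x (x ^ i)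
  commute-self-^ x i = sym (commute-^ˡ i refl)

  commute-·ˡ : ∀ {a b c} → Commute a c → Commute b c → Commute (a · b) c
  commute-·ˡ {a} {b} {c} ac≡ca bc≡cb = begin
    a · b · c    ≡⟨ assoc a b c ⟩
    a · (b · c)  ≡⟨ cong (a ·_) bc≡cb ⟩
    a · (c · b)  ≡⟨ assoc a c b ⟨
    a · c · b    ≡⟨ cong (_· b) ac≡ca ⟩
    c · a · b    ≡⟨ assoc c a b ⟩
    c · (a · b)  ∎
    where open ≡-Reasoning

  commute-· : ∀ {a b c d} → Commute a c → Commute a d → Commute b c → Commute b d → Commute (a · b) (c · d)
  commute-· ac≡ca ad≡da bc≡cb bd≡db =
    sym (commute-·ˡ (sym (commute-·ˡ ac≡ca bc≡cb)) (sym (commute-·ˡ ad≡da bd≡db)))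

  ^-distrib-· : ∀ {x y} k → Commute x y → (x · y) ^ k ≡ x ^ k · y ^ k
  ^-distrib-· zero xy≡yx = sym (idˡ e)
  ^-distrib-· {x} {y} (suc k) xy≡yx = begin
    x · y · (x · y) ^ k        ≡⟨ cong (x · y ·_) (^-distrib-· k xy≡yx) ⟩
    x · y · (x ^ k · y ^ k)    ≡⟨ solve 4 (λ x y a b → x ⊗ y ⊗ (a ⊗ b) ⊜ x ⊗ (y ⊗ a) ⊗ b) refl x y (x ^ k) (y ^ k) ⟩
    x · (y · x ^ k) · y ^ k    ≡⟨ cong (λ z → x · z · y ^ k) (commute-^ˡ k xy≡yx) ⟨
    x · (x ^ k · y) · y ^ k    ≡⟨ solve 4 (λ x y a b → x ⊗ (a ⊗ y) ⊗ b ⊜ x ⊗ a ⊗ (y ⊗ b)) refl x y (x ^ k) (y ^ k) ⟩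
    x · x ^ k · (y · y ^ k)    ∎
    where open ≡-Reasoning

  ^-absorbʳ : ∀ {x y} k → Commute x y → y ^ k ≡ e → (x · y) ^ k ≡ x ^ k
  ^-absorbʳ {x} {y} k xy≡yx yᵏ≡e = trans (^-distrib-· k xy≡yx) (trans (cong (x ^ k ·_) yᵏ≡e) (idʳ _))

  finite-order : ∀ x → ∃ λ m → 0 < m × x ^ m ≡ e
  finite-order x with Fin.pigeonhole (ℕ.n<1+n n) (λ (i : Fin (suc n)) → x ^ toℕ i)
  ... | i , j , i<j , xⁱ≡xʲ = toℕ j ∸ toℕ i , ℕ.m<n⇒0<n∸m i<j , period
    where
    period : x ^ (toℕ j ∸ toℕ i) ≡ e
    period = ∙-cancelʳ (x ^ toℕ i) _ _ (begin
      x ^ (toℕ j ∸ toℕ i) · x ^ toℕ i  ≡⟨ ^-+ x (toℕ j ∸ toℕ i) (toℕ i) ⟨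
      x ^ (toℕ j ∸ toℕ i + toℕ i)      ≡⟨ cong (x ^_) (ℕ.m∸n+n≡m (ℕ.<⇒≤ i<j)) ⟩
      x ^ toℕ j                        ≡⟨ xⁱ≡xʲ ⟨
      x ^ toℕ i                        ≡⟨ idˡ _ ⟨
      e · x ^ toℕ i                    ∎)
      where open ≡-Reasoning

  module _ {u v} (B : BézoutMod u v) where
    open BézoutMod B

    bézout-split : ∀ {x} → x ^ (u * v) ≡ e → x ≡ x ^ (v * i) · x ^ (u * j)
    bézout-split {x} xᵘᵛ≡e = begin
      x                           ≡⟨ idʳ x ⟨
      x · e                       ≡⟨ cong (x ·_) (^-∣ (u * v) (n∣m*n c) xᵘᵛ≡e) ⟨
      x ^ (1 + c * (u * v))       ≡⟨ cong (x ^_) bézout ⟨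
      x ^ (v * i + u * j)         ≡⟨ ^-+ x (v * i) (u * j) ⟩
      x ^ (v * i) · x ^ (u * j)   ∎
      where open ≡-Reasoning

    bézout-power : ∀ {y} → y ^ v ≡ e → y ^ (u * j) ≡ y
    bézout-power {y} yᵛ≡e = begin
      y ^ (u * j)                 ≡⟨ idˡ _ ⟨
      e · y ^ (u * j)             ≡⟨ cong (_· y ^ (u * j)) (^-∣ v (m∣m*n i) yᵛ≡e) ⟨
      y ^ (v * i) · y ^ (u * j)   ≡⟨ bézout-split (^-∣ v (n∣m*n u) yᵛ≡e) ⟨
      y                           ∎
      where open ≡-Reasoning

  coprime-exponents⇒≡e : ∀ {u v x} → Coprime u v → 0 < u → 0 < v → x ^ u ≡ e → x ^ v ≡ e → x ≡ e
  coprime-exponents⇒≡e {u} {v} {x} u⊥v 0<u 0<v xᵘ≡e xᵛ≡e = begin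
    x                           ≡⟨ bézout-split B (^-∣ u (m∣m*n v) xᵘ≡e) ⟩
    x ^ (v * i) · x ^ (u * j)   ≡⟨ cong₂ _·_ (^-∣ v (m∣m*n i) xᵛ≡e) (^-∣ u (m∣m*n j) xᵘ≡e) ⟩
    e · e                       ≡⟨ idˡ e ⟩
    e                           ∎
    where
    open ≡-Reasoning
    B : BézoutMod u v
    B = coprime⇒bézoutMod u⊥v 0<u 0<v
    open BézoutMod B

  coprime-decomposition : ∀ {u v} → Coprime u v → 0 < u → 0 < v → ∃₂ λ a b → ∀ x → x ^ (u * v) ≡ e →
                          x ≡ x ^ a · x ^ b × (x ^ a) ^ u ≡ e × (x ^ b) ^ v ≡ e
  coprime-decomposition {u} {v} u⊥v 0<u 0<v = v * i , u * j , λ x xᵘᵛ≡e →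
    bézout-split B xᵘᵛ≡e ,
    trans (^-*-assoc x (v * i) u) (^-∣ (u * v) (divides i (rearrangeᵘ u v i)) xᵘᵛ≡e) ,
    trans (^-*-assoc x (u * j) v) (^-∣ (u * v) (divides j (rearrangeᵛ u v j)) xᵘᵛ≡e)
    where
    B : BézoutMod u v
    B = coprime⇒bézoutMod u⊥v 0<u 0<v
    open BézoutMod B
    rearrangeᵘ : ∀ u v i → v * i * u ≡ i * (u * v)
    rearrangeᵘ = solve-∀
    rearrangeᵛ : ∀ u v j → u * j * v ≡ j * (u * v)
    rearrangeᵛ = solve-∀

  power-of-product : ∀ {u v x y} → Coprime u v → 0 < u → 0 < v → Commute x y →
                     x ^ u ≡ e → y ^ v ≡ e → ∃ λ k → 0 < k × (x · y) ^ k ≡ y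
  power-of-product {u} {v} {x} {y} u⊥v 0<u 0<v xy≡yx xᵘ≡e yᵛ≡e =
    u * (j + v) , ℕ.*-mono-≤ 0<u (ℕ.≤-trans 0<v (ℕ.m≤n+m v j)) , (begin
      (x · y) ^ (u * (j + v))              ≡⟨ ^-distrib-· (u * (j + v)) xy≡yx ⟩
      x ^ (u * (j + v)) · y ^ (u * (j + v)) ≡⟨ cong₂ _·_ (^-∣ u (m∣m*n (j + v)) xᵘ≡e) (cong (y ^_) (ℕ.*-distribˡ-+ u j v)) ⟩
      e · y ^ (u * j + u * v)              ≡⟨ idˡ _ ⟩
      y ^ (u * j + u * v)                  ≡⟨ ^-+ y (u * j) (u * v) ⟩
      y ^ (u * j) · y ^ (u * v)            ≡⟨ cong₂ _·_ (bézout-power B yᵛ≡e) (^-∣ v (n∣m*n u) yᵛ≡e) ⟩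
      y · e                                ≡⟨ idʳ y ⟩
      y                                    ∎)
    where
    open ≡-Reasoning
    B : BézoutMod u v
    B = coprime⇒bézoutMod u⊥v 0<u 0<v
    open BézoutMod B

  coprime-power≢e : ∀ {u v x} → x ≢ e → Coprime u v → 0 < u → 0 < v → x ^ u ≡ e → x ^ v ≢ e
  coprime-power≢e x≢e u⊥v 0<u 0<v xᵘ≡e xᵛ≡e = x≢e (coprime-exponents⇒≡e u⊥v 0<u 0<v xᵘ≡e xᵛ≡e)

-- Nilpotent groups

module UpperCentralSeries (G : FinGroup) where
  open GroupTheory G

  ⁅_,_⁆ : Elt G → Elt G → Elt G
  ⁅ x , y ⁆ = x · y · inv x · inv y

  commutator-·ˡ : ∀ x a y → ⁅ x · a , y ⁆ ≡ x · ⁅ a , y ⁆ · inv x · ⁅ x , y ⁆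
  commutator-·ˡ = solve 3 (λ x a y →
    x ⊗ a ⊗ y ⊗ (x ⊗ a) ⁻ ⊗ y ⁻ ⊜ x ⊗ (a ⊗ y ⊗ a ⁻ ⊗ y ⁻) ⊗ x ⁻ ⊗ (x ⊗ y ⊗ x ⁻ ⊗ y ⁻)) refl

  commutator-·ʳ : ∀ x y b → ⁅ x , y · b ⁆ ≡ ⁅ x , y ⁆ · (y · ⁅ x , b ⁆ · inv y)
  commutator-·ʳ = solve 3 (λ x y b →
    x ⊗ (y ⊗ b) ⊗ x ⁻ ⊗ (y ⊗ b) ⁻ ⊜ (x ⊗ y ⊗ x ⁻ ⊗ y ⁻) ⊗ (y ⊗ (x ⊗ b ⊗ x ⁻ ⊗ b ⁻) ⊗ y ⁻)) refl

  record IsNormalSubgroup (N : Elt G → Set) : Set where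
    field
      e∈          : N e
      ·-closed    : ∀ {x y} → N x → N y → N (x · y)
      inv-closed  : ∀ {x} → N x → N (inv x)
      conj-closed : ∀ h {x} → N x → N (h · x · inv h)

    ^-closed : ∀ {x} k → N x → N (x ^ k)
    ^-closed zero    x∈ = e∈
    ^-closed (suc k) x∈ = ·-closed x∈ (^-closed k x∈)

    ∣-closed : ∀ {z} m {k} → m ∣ k → N (z ^ m) → N (z ^ k)
    ∣-closed {z} m (divides q refl) zᵐ∈ =
      subst N (trans (^-*-assoc z m q) (cong (z ^_) (ℕ.*-comm m q))) (^-closed q zᵐ∈)

    coprime-powers∈ : ∀ {u v z} → Coprime u v → 0 < u → 0 < v → N (z ^ u) → N (z ^ v) → N z
    coprime-powers∈ {u} {v} {z} u⊥v 0<u 0<v zᵘ∈ zᵛ∈ =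
      subst N z≡ (·-closed (·-closed (∣-closed v (m∣m*n i) zᵛ∈) (∣-closed u (m∣m*n j) zᵘ∈))
                        (inv-closed (∣-closed u (∣-trans (m∣m*n v) (n∣m*n c)) zᵘ∈)))
      where
      open BézoutMod (coprime⇒bézoutMod u⊥v 0<u 0<v)
      z≡ : z ^ (v * i) · z ^ (u * j) · inv (z ^ (c * (u * v))) ≡ z
      z≡ = begin
        z ^ (v * i) · z ^ (u * j) · inv (z ^ (c * (u * v)))   ≡⟨ cong (λ w → w · inv (z ^ (c * (u * v)))) (^-+ z (v * i) (u * j)) ⟨
        z ^ (v * i + u * j) · inv (z ^ (c * (u * v)))         ≡⟨ cong (λ m → z ^ m · inv (z ^ (c * (u * v)))) bézout ⟩
        z · z ^ (c * (u * v)) · inv (z ^ (c * (u * v)))       ≡⟨ solve 2 (λ z w → z ⊗ w ⊗ w ⁻ ⊜ z) refl z (z ^ (c * (u * v))) ⟩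
        z                                                     ∎
        where open ≡-Reasoning

  upperCentral-isNormal : ∀ i → IsNormalSubgroup (UpperCentral G i)
  upperCentral-isNormal zero = record
    { e∈          = refl
    ; ·-closed    = λ { refl refl → idˡ e }
    ; inv-closed  = λ { refl → ε⁻¹≈ε }
    ; conj-closed = λ { h refl → trans (cong (_· inv h) (idʳ h)) (invʳ h) } }
  upperCentral-isNormal (suc i) = record
    { e∈          = λ g → subst Zᵢ (solve 1 (λ g → ι ⊜ ι ⊗ g ⊗ ι ⁻ ⊗ g ⁻) refl g) e∈
    ; ·-closed    = λ {x} {y} x∈ y∈ g → subst Zᵢ (solve 3 (λ x y g →
        x ⊗ (y ⊗ g ⊗ y ⁻ ⊗ g ⁻) ⊗ x ⁻ ⊗ (x ⊗ g ⊗ x ⁻ ⊗ g ⁻)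
          ⊜ x ⊗ y ⊗ g ⊗ (x ⊗ y) ⁻ ⊗ g ⁻) refl x y g)
        (·-closed (conj-closed x (y∈ g)) (x∈ g))
    ; inv-closed  = λ {x} x∈ g → subst Zᵢ (solve 2 (λ x g →
        x ⁻ ⊗ (x ⊗ g ⊗ x ⁻ ⊗ g ⁻) ⁻ ⊗ x ⁻ ⁻ ⊜ x ⁻ ⊗ g ⊗ x ⁻ ⁻ ⊗ g ⁻) refl x g)
        (conj-closed (inv x) (inv-closed (x∈ g)))
    ; conj-closed = λ h {x} x∈ g → subst Zᵢ (solve 3 (λ h x g →
        h ⊗ (x ⊗ (h ⁻ ⊗ g ⊗ h) ⊗ x ⁻ ⊗ (h ⁻ ⊗ g ⊗ h) ⁻) ⊗ h ⁻
          ⊜ h ⊗ x ⊗ h ⁻ ⊗ g ⊗ (h ⊗ x ⊗ h ⁻) ⁻ ⊗ g ⁻) refl h x g)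
        (conj-closed h (x∈ (inv h · g · h))) }
    where
    Zᵢ : Elt G → Set
    Zᵢ = UpperCentral G i
    open IsNormalSubgroup (upperCentral-isNormal i)

  module Modulo {N : Elt G → Set} (normal : IsNormalSubgroup N) where
    open IsNormalSubgroup normal

    infix 4 _≈_
    _≈_ : Elt G → Elt G → Set
    a ≈ b = N (a · inv b)

    ≈-setoid : Setoid 0ℓ 0ℓ
    ≈-setoid = record
      { Carrier = Elt G
      ; _≈_ = _≈_
      ; isEquivalence = record
        { refl  = λ {a} → subst N (sym (invʳ a)) e∈
        ; sym   = λ {a} {b} a≈b → subst N (solve 2 (λ a b → (a ⊗ b ⁻) ⁻ ⊜ b ⊗ a ⁻) refl a b) (inv-closed a≈b)
        ; trans = λ {a} {b} {c} a≈b b≈c →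
            subst N (solve 3 (λ a b c → a ⊗ b ⁻ ⊗ (b ⊗ c ⁻) ⊜ a ⊗ c ⁻) refl a b c) (·-closed a≈b b≈c) } }

    open Setoid ≈-setoid public using () renaming (refl to ≈-refl; sym to ≈-sym; reflexive to ≡⇒≈)

    ·-cong : ∀ {a a′ b b′} → a ≈ a′ → b ≈ b′ → a · b ≈ a′ · b′
    ·-cong {a} {a′} {b} {b′} a≈a′ b≈b′ = subst N
      (solve 4 (λ a a′ b b′ → a ⊗ (b ⊗ b′ ⁻) ⊗ a ⁻ ⊗ (a ⊗ a′ ⁻) ⊜ a ⊗ b ⊗ (a′ ⊗ b′) ⁻) refl a a′ b b′)
      (·-closed (conj-closed a b≈b′) a≈a′)

    ≈e⇒∈ : ∀ {a} → a ≈ e → N a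
    ≈e⇒∈ {a} = subst N (trans (cong (a ·_) ε⁻¹≈ε) (idʳ a))

    Central : Elt G → Set
    Central z = ∀ g → z · g ≈ g · z

    central-^ : ∀ {z} → Central z → ∀ k → Central (z ^ k)
    central-^ {z} central zero    g = ≡⇒≈ (trans (idˡ g) (sym (idʳ g)))
    central-^ {z} central (suc k) g = begin
      z · z ^ k · g    ≡⟨ assoc _ _ _ ⟩
      z · (z ^ k · g)  ≈⟨ ·-cong ≈-refl (central-^ central k g) ⟩
      z · (g · z ^ k)  ≡⟨ assoc _ _ _ ⟨
      z · g · z ^ k    ≈⟨ ·-cong (central g) ≈-refl ⟩
      g · z · z ^ k    ≡⟨ assoc _ _ _ ⟩
      g · (z · z ^ k)  ∎
      where open SetoidReasoning ≈-setoid

    central-conj : ∀ {z} → Central z → ∀ h → h · z · inv h ≈ z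
    central-conj {z} central h = begin
      h · z · inv h   ≈⟨ ·-cong (≈-sym (central h)) ≈-refl ⟩
      z · h · inv h   ≡⟨ solve 2 (λ z h → z ⊗ h ⊗ h ⁻ ⊜ z) refl z h ⟩
      z               ∎
      where open SetoidReasoning ≈-setoid

    module _ {x y} (central : Central ⁅ x , y ⁆) where

      commutator-^ˡ : ∀ k → ⁅ x ^ k , y ⁆ ≈ ⁅ x , y ⁆ ^ k
      commutator-^ˡ zero    = ≡⇒≈ (solve 1 (λ y → ι ⊗ y ⊗ ι ⁻ ⊗ y ⁻ ⊜ ι) refl y)
      commutator-^ˡ (suc k) = begin
        ⁅ x · x ^ k , y ⁆                       ≡⟨ commutator-·ˡ x (x ^ k) y ⟩
        x · ⁅ x ^ k , y ⁆ · inv x · ⁅ x , y ⁆   ≈⟨ ·-cong (·-cong (·-cong ≈-refl (commutator-^ˡ k)) ≈-refl) ≈-refl ⟩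
        x · ⁅ x , y ⁆ ^ k · inv x · ⁅ x , y ⁆   ≈⟨ ·-cong (central-conj (central-^ central k) x) ≈-refl ⟩
        ⁅ x , y ⁆ ^ k · ⁅ x , y ⁆               ≡⟨ commute-self-^ ⁅ x , y ⁆ k ⟨
        ⁅ x , y ⁆ · ⁅ x , y ⁆ ^ k               ∎
        where open SetoidReasoning ≈-setoid

      commutator-^ʳ : ∀ k → ⁅ x , y ^ k ⁆ ≈ ⁅ x , y ⁆ ^ k
      commutator-^ʳ zero    = ≡⇒≈ (solve 1 (λ x → x ⊗ ι ⊗ x ⁻ ⊗ ι ⁻ ⊜ ι) refl x)
      commutator-^ʳ (suc k) = begin
        ⁅ x , y · y ^ k ⁆                       ≡⟨ commutator-·ʳ x y (y ^ k) ⟩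
        ⁅ x , y ⁆ · (y · ⁅ x , y ^ k ⁆ · inv y) ≈⟨ ·-cong ≈-refl (·-cong (·-cong ≈-refl (commutator-^ʳ k)) ≈-refl) ⟩
        ⁅ x , y ⁆ · (y · ⁅ x , y ⁆ ^ k · inv y) ≈⟨ ·-cong ≈-refl (central-conj (central-^ central k) y) ⟩
        ⁅ x , y ⁆ · ⁅ x , y ⁆ ^ k               ∎
        where open SetoidReasoning ≈-setoid

      commutator∈ : ∀ {u v} → Coprime u v → 0 < u → 0 < v → x ^ u ≡ e → y ^ v ≡ e → N ⁅ x , y ⁆
      commutator∈ {u} {v} u⊥v 0<u 0<v xᵘ≡e yᵛ≡e =
        coprime-powers∈ u⊥v 0<u 0<v (≈e⇒∈ ⁅x,y⁆ᵘ≈e) (≈e⇒∈ ⁅x,y⁆ᵛ≈e)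
        where
        open SetoidReasoning ≈-setoid
        ⁅x,y⁆ᵘ≈e : ⁅ x , y ⁆ ^ u ≈ e
        ⁅x,y⁆ᵘ≈e = begin
          ⁅ x , y ⁆ ^ u  ≈⟨ commutator-^ˡ u ⟨
          ⁅ x ^ u , y ⁆  ≡⟨ cong (λ a → ⁅ a , y ⁆) xᵘ≡e ⟩
          ⁅ e , y ⁆      ≈⟨ commutator-^ˡ 0 ⟩
          e              ∎
        ⁅x,y⁆ᵛ≈e : ⁅ x , y ⁆ ^ v ≈ e
        ⁅x,y⁆ᵛ≈e = begin
          ⁅ x , y ⁆ ^ v  ≈⟨ commutator-^ʳ v ⟨
          ⁅ x , y ^ v ⁆  ≡⟨ cong (λ b → ⁅ x , b ⁆) yᵛ≡e ⟩
          ⁅ x , e ⁆      ≈⟨ commutator-^ʳ 0 ⟩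
          e              ∎

  coprime-orders-commute : Nilpotent G → ∀ {u v x y} → Coprime u v → 0 < u → 0 < v →
                           x ^ u ≡ e → y ^ v ≡ e → Commute x y
  coprime-orders-commute (c , all∈Zc) {x = x} {y} u⊥v 0<u 0<v xᵘ≡e yᵛ≡e = begin
    x · y              ≡⟨ solve 2 (λ x y → x ⊗ y ⊜ (x ⊗ y ⊗ x ⁻ ⊗ y ⁻) ⊗ y ⊗ x) refl x y ⟩
    ⁅ x , y ⁆ · y · x  ≡⟨ cong (λ z → z · y · x) (descend c (all∈Zc ⁅ x , y ⁆)) ⟩
    e · y · x          ≡⟨ cong (_· x) (idˡ y) ⟩
    y · x              ∎
    where
    open ≡-Reasoning
    descend : ∀ i → UpperCentral G i ⁅ x , y ⁆ → ⁅ x , y ⁆ ≡ e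
    descend zero    ⁅x,y⁆∈Z₀ = ⁅x,y⁆∈Z₀
    descend (suc i) ⁅x,y⁆∈Zᵢ₊₁ = descend i (commutator∈ central u⊥v 0<u 0<v xᵘ≡e yᵛ≡e)
      where
      open Modulo (upperCentral-isNormal i)
      central : Central ⁅ x , y ⁆
      central g = subst (UpperCentral G i)
        (solve 2 (λ z g → z ⊗ g ⊗ z ⁻ ⊗ g ⁻ ⊜ z ⊗ g ⊗ (g ⊗ z) ⁻) refl ⁅ x , y ⁆ g) (⁅x,y⁆∈Zᵢ₊₁ g)

-- Counting words and their rotations

χ : ∀ {P : Set} → Dec P → ℕ
χ (yes _) = 1
χ (no  _) = 0

χ-yes : ∀ {P : Set} → P → (P? : Dec P) → χ P? ≡ 1
χ-yes p (yes _) = refl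
χ-yes p (no ¬p) = contradiction p ¬p

χ-no : ∀ {P : Set} → ¬ P → (P? : Dec P) → χ P? ≡ 0
χ-no ¬p (yes p) = contradiction p ¬p
χ-no ¬p (no _)  = refl

χ-positive : ∀ {P : Set} (P? : Dec P) → 0 < χ P? → P
χ-positive (yes p) _ = p

χ-cong : ∀ {P Q : Set} → (P → Q) → (Q → P) → (P? : Dec P) (Q? : Dec Q) → χ P? ≡ χ Q?
χ-cong P→Q Q→P (yes p) Q?      = sym (χ-yes (P→Q p) Q?)
χ-cong P→Q Q→P (no ¬p) Q?      = sym (χ-no (¬p ∘ Q→P) Q?)

χ-split : ∀ {P Q : Set} (P? : Dec P) (Q? : Dec Q) → χ P? ≡ χ (P? ×-dec Q?) + χ (P? ×-dec ¬? Q?)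
χ-split (yes _) (yes _) = refl
χ-split (yes _) (no  _) = refl
χ-split (no  _) _       = refl

∑-const : ∀ m c → ∑[ i < m ] c ≡ m * c
∑-const zero    c = refl
∑-const (suc m) c = cong (c +_) (∑-const m c)

∑-zero : ∀ m {f : Fin m → ℕ} → (∀ i → f i ≡ 0) → sum f ≡ 0
∑-zero m f≡0 = trans (sum-cong-≗ f≡0) (trans (∑-const m 0) (ℕ.*-zeroʳ m))

∑-indicator : ∀ m (j : Fin m) → ∑[ i < m ] χ (i Fin.≟ j) ≡ 1
∑-indicator (suc m) Fin.zero = cong suc (∑-zero m (λ i → χ-no (λ ()) (Fin.suc i Fin.≟ Fin.zero)))
∑-indicator (suc m) (Fin.suc j) = cong₂ _+_
  (χ-no (λ ()) (Fin.zero Fin.≟ Fin.suc j))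
  (trans (sum-cong-≗ (λ i → χ-cong Fin.suc-injective (cong Fin.suc) (Fin.suc i Fin.≟ Fin.suc j) (i Fin.≟ j)))
         (∑-indicator m j))

∑-positive : ∀ m (f : Fin m → ℕ) → 0 < sum f → ∃ λ i → 0 < f i
∑-positive (suc m) f 0<∑ with f Fin.zero in eq
... | suc _ = Fin.zero , subst (0 <_) (sym eq) z<s
... | zero with ∑-positive m (f ∘ Fin.suc) 0<∑
...   | i , 0<fi = Fin.suc i , 0<fi

module WordSums (n : ℕ) where

  ∑ʷ : ℕ → (List (Fin n) → ℕ) → ℕ
  ∑ʷ zero    f = f []
  ∑ʷ (suc k) f = ∑[ x < n ] ∑ʷ k (f ∘ (x ∷_))

  ∑ʷ-cong : ∀ k {f g : List (Fin n) → ℕ} → (∀ w → length w ≡ k → f w ≡ g w) → ∑ʷ k f ≡ ∑ʷ k g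
  ∑ʷ-cong zero    f≗g = f≗g [] refl
  ∑ʷ-cong (suc k) f≗g = sum-cong-≗ (λ x → ∑ʷ-cong k (λ w |w|≡k → f≗g (x ∷ w) (cong suc |w|≡k)))

  ∑ʷ-distrib-+ : ∀ k (f g : List (Fin n) → ℕ) → ∑ʷ k (λ w → f w + g w) ≡ ∑ʷ k f + ∑ʷ k g
  ∑ʷ-distrib-+ zero    f g = refl
  ∑ʷ-distrib-+ (suc k) f g = trans (sum-cong-≗ (λ x → ∑ʷ-distrib-+ k (f ∘ (x ∷_)) (g ∘ (x ∷_))))
                                   (∑-distrib-+ (λ x → ∑ʷ k (f ∘ (x ∷_))) (λ x → ∑ʷ k (g ∘ (x ∷_))))

  ∑ʷ-const : ∀ k c → ∑ʷ k (λ _ → c) ≡ n ℕ.^ k * c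
  ∑ʷ-const zero    c = sym (ℕ.+-identityʳ c)
  ∑ʷ-const (suc k) c = trans (sum-cong-≗ {n} (λ _ → ∑ʷ-const k c))
                             (trans (∑-const n (n ℕ.^ k * c)) (sym (ℕ.*-assoc n (n ℕ.^ k) c)))

  ∑ʷ-zero : ∀ k {f} → (∀ w → f w ≡ 0) → ∑ʷ k f ≡ 0
  ∑ʷ-zero k {f} f≡0 = trans (∑ʷ-cong k (λ w _ → f≡0 w)) (trans (∑ʷ-const k 0) (ℕ.*-zeroʳ (n ℕ.^ k)))

  ∑ʷ-∑-comm : ∀ k m (f : List (Fin n) → Fin m → ℕ) →
              ∑ʷ k (λ w → ∑[ j < m ] f w j) ≡ ∑[ j < m ] ∑ʷ k (λ w → f w j)
  ∑ʷ-∑-comm zero    m f = refl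
  ∑ʷ-∑-comm (suc k) m f = trans (sum-cong-≗ (λ x → ∑ʷ-∑-comm k m (f ∘ (x ∷_))))
                                (∑-comm (λ x j → ∑ʷ k (λ w → f (x ∷ w) j)))

  ∑ʷ-positive : ∀ k (f : List (Fin n) → ℕ) → 0 < ∑ʷ k f → ∃ λ w → length w ≡ k × 0 < f w
  ∑ʷ-positive zero    f 0<f[] = [] , refl , 0<f[]
  ∑ʷ-positive (suc k) f 0<∑ with ∑-positive n _ 0<∑
  ... | x , 0<∑ₓ with ∑ʷ-positive k _ 0<∑ₓ
  ...   | w , |w|≡k , 0<fxw = x ∷ w , cong suc |w|≡k , 0<fxw

  _≟ʷ_ : DecidableEquality (List (Fin n))
  _≟ʷ_ = List.≡-dec Fin._≟_

  ∑ʷ-indicator : ∀ k v → length v ≡ k → ∑ʷ k (λ w → χ (w ≟ʷ v)) ≡ 1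
  ∑ʷ-indicator zero    []      refl = refl
  ∑ʷ-indicator (suc k) (y ∷ v) |v|≡k = trans (sum-cong-≗ column) (∑-indicator n y)
    where
    column′ : ∀ x → Dec (x ≡ y) → ∑ʷ k (λ w → χ ((x ∷ w) ≟ʷ (y ∷ v))) ≡ χ (x Fin.≟ y)
    column′ x (yes refl) = trans (∑ʷ-cong k (λ w _ → χ-cong List.∷-injectiveʳ (cong (x ∷_)) _ _))
                                 (trans (∑ʷ-indicator k v (ℕ.suc-injective |v|≡k)) (sym (χ-yes refl (x Fin.≟ y))))
    column′ x (no x≢y)   = trans (∑ʷ-zero k (λ w → χ-no (x≢y ∘ List.∷-injectiveˡ) _)) (sym (χ-no x≢y (x Fin.≟ y)))
    column : ∀ x → ∑ʷ k (λ w → χ ((x ∷ w) ≟ʷ (y ∷ v))) ≡ χ (x Fin.≟ y)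
    column x = column′ x (x Fin.≟ y)

module _ {A : Set} (f : A → A) where

  iterate-+ : ∀ x a b → iterate f x (a + b) ≡ iterate f (iterate f x a) b
  iterate-+ x zero    b = refl
  iterate-+ x (suc a) b = iterate-+ (f x) a b

  iterate-fixed : ∀ {x} → f x ≡ x → ∀ k → iterate f x k ≡ x
  iterate-fixed fx≡x zero    = refl
  iterate-fixed fx≡x (suc k) = trans (cong (λ y → iterate f y k) fx≡x) (iterate-fixed fx≡x k)

  iterate-* : ∀ {x d} → iterate f x d ≡ x → ∀ s → iterate f x (s * d) ≡ x
  iterate-* {x} {d} fᵈx≡x zero    = refl
  iterate-* {x} {d} fᵈx≡x (suc s) = begin
    iterate f x (d + s * d)                ≡⟨ iterate-+ x d (s * d) ⟩
    iterate f (iterate f x d) (s * d)      ≡⟨ cong (λ y → iterate f y (s * d)) fᵈx≡x ⟩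
    iterate f x (s * d)                    ≡⟨ iterate-* fᵈx≡x s ⟩
    x                                      ∎
    where open ≡-Reasoning

module _ {A : Set} where

  rotate : List A → List A
  rotate []      = []
  rotate (x ∷ w) = w ++ [ x ]

  rotate^ : ℕ → List A → List A
  rotate^ k w = iterate rotate w k

  length-rotate : ∀ w → length (rotate w) ≡ length w
  length-rotate []      = refl
  length-rotate (x ∷ w) = trans (List.length-++ w) (ℕ.+-comm (length w) 1)

  length-rotate^ : ∀ k w → length (rotate^ k w) ≡ length w
  length-rotate^ zero    w = refl
  length-rotate^ (suc k) w = trans (length-rotate^ k (rotate w)) (length-rotate w)

  rotate^-++ : ∀ u w → rotate^ (length u) (u ++ w) ≡ w ++ u
  rotate^-++ []      w = sym (List.++-identityʳ w)
  rotate^-++ (x ∷ u) w = begin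
    rotate^ (length u) ((u ++ w) ++ [ x ])  ≡⟨ cong (rotate^ (length u)) (List.++-assoc u w [ x ]) ⟩
    rotate^ (length u) (u ++ w ++ [ x ])    ≡⟨ rotate^-++ u (w ++ [ x ]) ⟩
    (w ++ [ x ]) ++ u                       ≡⟨ List.++-assoc w [ x ] u ⟩
    w ++ x ∷ u                              ∎
    where open ≡-Reasoning

  rotate^-length : ∀ w → rotate^ (length w) w ≡ w
  rotate^-length w = trans (cong (rotate^ (length w)) (sym (List.++-identityʳ w))) (rotate^-++ w [])

  rotate-fixed⇒replicate : ∀ x w → rotate (x ∷ w) ≡ x ∷ w → x ∷ w ≡ replicate (suc (length w)) x
  rotate-fixed⇒replicate x w fixed = cong (x ∷_) (snoc≡cons w fixed)
    where
    snoc≡cons : ∀ w → w ++ [ x ] ≡ x ∷ w → w ≡ replicate (length w) x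
    snoc≡cons []      _  = refl
    snoc≡cons (y ∷ w) eq with List.∷-injectiveˡ eq
    ... | refl = cong (y ∷_) (snoc≡cons w (List.∷-injectiveʳ eq))

  rotate-replicate : ∀ k (x : A) → rotate (replicate k x) ≡ replicate k x
  rotate-replicate zero    x = refl
  rotate-replicate (suc k) x = snoc k
    where
    snoc : ∀ k → replicate k x ++ [ x ] ≡ x ∷ replicate k x
    snoc zero    = refl
    snoc (suc k) = cong (x ∷_) (snoc k)

module PrimeLength {A : Set} {q} (q-prime : Prime q) where

  private instance
    q≢0 : NonZero q
    q≢0 = prime⇒nonZero q-prime

  0<q : 0 < q
  0<q = 0<prime q-prime

  rotate^-q : ∀ {w : List A} → length w ≡ q → rotate^ q w ≡ w
  rotate^-q {w} refl = rotate^-length w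

  rotate^-% : ∀ {w : List A} → length w ≡ q → ∀ m → rotate^ m w ≡ rotate^ (m % q) w
  rotate^-% {w} |w|≡q m = begin
    rotate^ m w                                   ≡⟨ cong (λ k → rotate^ k w) (m≡m%n+[m/n]*n m q) ⟩
    rotate^ (m % q + m / q * q) w                 ≡⟨ iterate-+ rotate w (m % q) (m / q * q) ⟩
    rotate^ (m / q * q) (rotate^ (m % q) w)       ≡⟨ iterate-* rotate (rotate^-q (trans (length-rotate^ (m % q) w) |w|≡q)) (m / q) ⟩
    rotate^ (m % q) w                             ∎
    where open ≡-Reasoning

  -- d generates ℤ/qℤ, so the rotation by 1 is a power of the rotation by d.
  rotate^-fixed⇒rotate-fixed : ∀ {w : List A} {d} → length w ≡ q → 0 < d → d < q → rotate^ d w ≡ w → rotate w ≡ w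
  rotate^-fixed⇒rotate-fixed {w} {d} |w|≡q 0<d d<q fixed = begin
    rotate w                                         ≡⟨ iterate-* rotate (rotate^-q (trans (length-rotate w) |w|≡q)) (c * d) ⟨
    rotate^ (c * d * q) (rotate w)                   ≡⟨ cong (λ k → rotate^ k (rotate w)) (ℕ.*-assoc c d q) ⟩
    rotate^ (1 + c * (d * q)) w                      ≡⟨ cong (λ k → rotate^ k w) bézout ⟨
    rotate^ (q * i + d * j) w                        ≡⟨ iterate-+ rotate w (q * i) (d * j) ⟩
    rotate^ (d * j) (rotate^ (q * i) w)              ≡⟨ cong (rotate^ (d * j)) rotate^qi≡id ⟩
    rotate^ (d * j) w                                ≡⟨ cong (λ k → rotate^ k w) (ℕ.*-comm d j) ⟩
    rotate^ (j * d) w                                ≡⟨ iterate-* rotate fixed j ⟩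
    w                                                ∎
    where
    open ≡-Reasoning
    instance
      d≢0 : NonZero d
      d≢0 = >-nonZero 0<d
    open BézoutMod (coprime⇒bézoutMod (Coprimality.sym (prime⇒coprime q-prime d<q)) 0<d 0<q)
    rotate^qi≡id : rotate^ (q * i) w ≡ w
    rotate^qi≡id = trans (cong (λ k → rotate^ k w) (ℕ.*-comm q i)) (iterate-* rotate (rotate^-q |w|≡q) i)

  rotate^-distinct : ∀ {w : List A} {i j} → length w ≡ q → rotate w ≢ w → i < j → j < q →
                     rotate^ i w ≢ rotate^ j w
  rotate^-distinct {w} {i} {j} |w|≡q not-fixed i<j j<q wᵢ≡wⱼ = not-fixed (begin
    rotate w     ≡⟨ cong rotate w≡wᵢ ⟩
    rotate wᵢ    ≡⟨ wᵢ-fixed ⟩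
    wᵢ           ≡⟨ w≡wᵢ ⟨
    w            ∎)
    where
    open ≡-Reasoning
    wᵢ : List A
    wᵢ = rotate^ i w
    i+[j∸i]≡j : i + (j ∸ i) ≡ j
    i+[j∸i]≡j = ℕ.m+[n∸m]≡n (ℕ.<⇒≤ i<j)
    wᵢ-fixed : rotate wᵢ ≡ wᵢ
    wᵢ-fixed = rotate^-fixed⇒rotate-fixed (trans (length-rotate^ i w) |w|≡q) (ℕ.m<n⇒0<n∸m i<j)
      (ℕ.≤-<-trans (ℕ.m∸n≤m j i) j<q)
      (trans (sym (iterate-+ rotate w i (j ∸ i))) (trans (cong (λ k → rotate^ k w) i+[j∸i]≡j) (sym wᵢ≡wⱼ)))
    w≡wᵢ : w ≡ wᵢ
    w≡wᵢ = begin
      w                           ≡⟨ rotate^-q |w|≡q ⟨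
      rotate^ q w                 ≡⟨ cong (λ k → rotate^ k w) (ℕ.m+[n∸m]≡n (ℕ.<⇒≤ (ℕ.<-trans i<j j<q))) ⟨
      rotate^ (i + (q ∸ i)) w     ≡⟨ iterate-+ rotate w i (q ∸ i) ⟩
      rotate^ (q ∸ i) wᵢ          ≡⟨ iterate-fixed rotate wᵢ-fixed (q ∸ i) ⟩
      wᵢ                          ∎

  rotate^-injective : ∀ {w : List A} → length w ≡ q → rotate w ≢ w →
                      ∀ (i j : Fin q) → rotate^ (toℕ i) w ≡ rotate^ (toℕ j) w → i ≡ j
  rotate^-injective |w|≡q not-fixed i j wᵢ≡wⱼ with Fin.<-cmp i j
  ... | tri< i<j _ _ = contradiction wᵢ≡wⱼ (rotate^-distinct |w|≡q not-fixed i<j (Fin.toℕ<n j))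
  ... | tri≈ _ i≡j _ = i≡j
  ... | tri> _ _ j<i = contradiction (sym wᵢ≡wⱼ) (rotate^-distinct |w|≡q not-fixed j<i (Fin.toℕ<n i))

  rotate^-pred : ∀ {w : List A} → length w ≡ q → rotate^ (q ∸ 1) (rotate w) ≡ w
  rotate^-pred {w} |w|≡q = begin
    rotate^ (q ∸ 1) (rotate w)   ≡⟨ iterate-+ rotate w 1 (q ∸ 1) ⟨
    rotate^ (1 + (q ∸ 1)) w      ≡⟨ cong (λ k → rotate^ k w) (ℕ.m+[n∸m]≡n 0<q) ⟩
    rotate^ q w                  ≡⟨ rotate^-q |w|≡q ⟩
    w                            ∎
    where open ≡-Reasoning

module RotationOrbits (n : ℕ) {q} (q-prime : Prime q) where
  open WordSums n
  open PrimeLength {Fin n} q-prime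

  private instance
    q≢0 : NonZero q
    q≢0 = prime⇒nonZero q-prime

  Word : Set
  Word = List (Fin n)

  InOrbit : Word → Word → Set
  InOrbit a b = ∃ λ (j : Fin q) → b ≡ rotate^ (toℕ j) a

  inOrbit? : ∀ a b → Dec (InOrbit a b)
  inOrbit? a b = Fin.any? (λ j → b ≟ʷ rotate^ (toℕ j) a)

  rotate^∈orbit : ∀ {a} → length a ≡ q → ∀ m → InOrbit a (rotate^ m a)
  rotate^∈orbit {a} |a|≡q m = fromℕ< (m%n<n m q) ,
    trans (rotate^-% |a|≡q m) (cong (λ k → rotate^ k a) (sym (Fin.toℕ-fromℕ< (m%n<n m q))))

  inOrbit-rotate⁻¹ : ∀ {a b} → length a ≡ q → length b ≡ q → InOrbit a (rotate b) → InOrbit a b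
  inOrbit-rotate⁻¹ {a} {b} |a|≡q |b|≡q (j , rotate-b≡) = subst (InOrbit a) b≡ (rotate^∈orbit |a|≡q (toℕ j + (q ∸ 1)))
    where
    b≡ : rotate^ (toℕ j + (q ∸ 1)) a ≡ b
    b≡ = trans (iterate-+ rotate a (toℕ j) (q ∸ 1)) (trans (cong (rotate^ (q ∸ 1)) (sym rotate-b≡)) (rotate^-pred |b|≡q))

  ∑-orbit : ∀ {a} → length a ≡ q → rotate a ≢ a → ∑ʷ q (λ b → χ (inOrbit? a b)) ≡ q
  ∑-orbit {a} |a|≡q not-fixed = begin
    ∑ʷ q (λ b → χ (inOrbit? a b))                        ≡⟨ ∑ʷ-cong q (λ b _ → orbit-indicator b (inOrbit? a b)) ⟩
    ∑ʷ q (λ b → ∑[ j < q ] χ (b ≟ʷ rotate^ (toℕ j) a))   ≡⟨ ∑ʷ-∑-comm q q _ ⟩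
    ∑[ j < q ] ∑ʷ q (λ b → χ (b ≟ʷ rotate^ (toℕ j) a))   ≡⟨ sum-cong-≗ {q} (λ j → ∑ʷ-indicator q _ (|aⱼ|≡q j)) ⟩
    ∑[ j < q ] 1                                          ≡⟨ ∑-const q 1 ⟩
    q * 1                                                 ≡⟨ ℕ.*-identityʳ q ⟩
    q                                                     ∎
    where
    open ≡-Reasoning
    |aⱼ|≡q : ∀ (j : Fin q) → length (rotate^ (toℕ j) a) ≡ q
    |aⱼ|≡q j = trans (length-rotate^ (toℕ j) a) |a|≡q
    orbit-indicator : ∀ b → (b∈? : Dec (InOrbit a b)) → χ b∈? ≡ ∑[ j < q ] χ (b ≟ʷ rotate^ (toℕ j) a)
    orbit-indicator b (yes (j₀ , b≡aⱼ₀)) = sym (trans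
      (sum-cong-≗ {q} (λ j → χ-cong (λ b≡aⱼ → rotate^-injective |a|≡q not-fixed j j₀ (trans (sym b≡aⱼ) b≡aⱼ₀))
                                    (λ { refl → b≡aⱼ₀ }) _ (j Fin.≟ j₀)))
      (∑-indicator q j₀))
    orbit-indicator b (no b∉) = sym (∑-zero q (λ j → χ-no (λ b≡aⱼ → b∉ (j , b≡aⱼ)) _))

  count : ∀ {P : Pred Word _} → Decidable P → ℕ
  count P? = ∑ʷ q (λ b → χ (P? b))

  RotationClosed : Pred Word _ → Set
  RotationClosed P = ∀ {b} → length b ≡ q → P b → P (rotate b)

  FixedPointFree : Pred Word _ → Set
  FixedPointFree P = ∀ {b} → length b ≡ q → P b → rotate b ≢ b

  count≡0⊎member : ∀ {P} (P? : Decidable P) → count P? ≡ 0 ⊎ ∃ λ a → length a ≡ q × P a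
  count≡0⊎member P? with count P? in count≡
  ... | zero  = inj₁ refl
  ... | suc _ with ∑ʷ-positive q (λ b → χ (P? b)) (subst (0 <_) (sym count≡) z<s)
  ...   | a , |a|≡q , 0<χ = inj₂ (a , |a|≡q , χ-positive (P? a) 0<χ)

  -- Removing the orbit of a member lowers the count by exactly q.
  prime∣count : ∀ {P} (P? : Decidable P) → RotationClosed P → FixedPointFree P → q ∣ count P?
  prime∣count P? closed free = go P? closed free (<-wellFounded _)
    where
    go : ∀ {P} (P? : Decidable P) → RotationClosed P → FixedPointFree P → Acc _<_ (count P?) → q ∣ count P?
    go {P} P? closed free (acc rec) with count≡0⊎member P?
    ... | inj₁ count≡0 = subst (q ∣_) (sym count≡0) (q ∣0)
    ... | inj₂ (a , |a|≡q , Pa) = subst (q ∣_) (sym split) (∣m∣n⇒∣m+n q∣count′ ∣-refl)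
      where
      P′ : Pred Word _
      P′ b = P b × ¬ InOrbit a b
      P′? : Decidable P′
      P′? b = P? b ×-dec ¬? (inOrbit? a b)
      closed^ : ∀ k {b} → length b ≡ q → P b → P (rotate^ k b)
      closed^ zero    |b|≡q Pb = Pb
      closed^ (suc k) {b} |b|≡q Pb = closed^ k (trans (length-rotate b) |b|≡q) (closed |b|≡q Pb)
      pointwise : ∀ b (b∈? : Dec (InOrbit a b)) → χ (P? b) ≡ χ (P′? b) + χ b∈?
      pointwise b (yes b∈@(j , refl)) = trans (χ-yes (closed^ (toℕ j) |a|≡q Pa) (P? b))
                                              (sym (cong (_+ 1) (χ-no (λ P′b → proj₂ P′b b∈) (P′? b))))
      pointwise b (no  b∉)            = trans (χ-cong (_, b∉) proj₁ (P? b) (P′? b)) (sym (ℕ.+-identityʳ _))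
      split : count P? ≡ count P′? + q
      split = trans (∑ʷ-cong q (λ b _ → pointwise b (inOrbit? a b)))
                    (trans (∑ʷ-distrib-+ q _ _) (cong (count P′? +_) (∑-orbit |a|≡q (free |a|≡q Pa))))
      closed′ : RotationClosed P′
      closed′ |b|≡q (Pb , b∉) = closed |b|≡q Pb , λ rb∈ → b∉ (inOrbit-rotate⁻¹ |a|≡q |b|≡q rb∈)
      free′ : FixedPointFree P′
      free′ |b|≡q (Pb , _) = free |b|≡q Pb
      q∣count′ : q ∣ count P′?
      q∣count′ = go P′? closed′ free′ (rec (subst (count P′? <_) (sym split) (ℕ.m<m+n (count P′?) 0<q)))

-- Cauchy's theorem

module CauchyTheorem (G : FinGroup) where
  open GroupTheory G
  open WordSums n

  product : List (Elt G) → Elt G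
  product = foldr _·_ e

  product-++ : ∀ u v → product (u ++ v) ≡ product u · product v
  product-++ []      v = sym (idˡ _)
  product-++ (x ∷ u) v = trans (cong (x ·_) (product-++ u v)) (sym (assoc _ _ _))

  product-replicate : ∀ k x → product (replicate k x) ≡ x ^ k
  product-replicate zero    x = refl
  product-replicate (suc k) x = cong (x ·_) (product-replicate k x)

  product-rotate : ∀ w → product w ≡ e → product (rotate w) ≡ e
  product-rotate []      refl = refl
  product-rotate (x ∷ w) xw≡e = begin
    product (w ++ [ x ])    ≡⟨ product-++ w [ x ] ⟩
    product w · (x · e)     ≡⟨ cong (product w ·_) (idʳ x) ⟩
    product w · x           ≡⟨ cong (_· x) (inverseʳ-unique x (product w) xw≡e) ⟩
    inv x · x               ≡⟨ invˡ x ⟩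
    e                       ∎
    where open ≡-Reasoning

  -- The first letter of a word with product e is determined by the others.
  ∑-product≡e : ∀ k → ∑ʷ (suc k) (λ w → χ (product w Fin.≟ e)) ≡ n ℕ.^ k
  ∑-product≡e k = begin
    ∑[ x < n ] ∑ʷ k (λ w → χ (x · product w Fin.≟ e))   ≡⟨ ∑ʷ-∑-comm k n (λ w x → χ (x · product w Fin.≟ e)) ⟨
    ∑ʷ k (λ w → ∑[ x < n ] χ (x · product w Fin.≟ e))   ≡⟨ ∑ʷ-cong k (λ w _ → one-solution (product w)) ⟩
    ∑ʷ k (λ _ → 1)                                       ≡⟨ ∑ʷ-const k 1 ⟩
    n ℕ.^ k * 1                                          ≡⟨ ℕ.*-identityʳ _ ⟩
    n ℕ.^ k                                              ∎
    where
    open ≡-Reasoning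
    one-solution : ∀ p → ∑[ x < n ] χ (x · p Fin.≟ e) ≡ 1
    one-solution p = trans
      (sum-cong-≗ {n} (λ x → χ-cong (inverseˡ-unique x p) (λ { refl → invˡ p }) (x · p Fin.≟ e) (x Fin.≟ inv p)))
      (∑-indicator n (inv p))

  module _ {q} (q-prime : Prime q) where
    open PrimeLength {Elt G} q-prime
    open RotationOrbits n q-prime

    Balanced : List (Elt G) → Set
    Balanced w = product w ≡ e

    balanced? : Decidable Balanced
    balanced? w = product w Fin.≟ e

    fixed? : Decidable (λ w → rotate w ≡ w)
    fixed? w = rotate w ≟ʷ w

    balanced-fixed? : Decidable (λ w → Balanced w × rotate w ≡ w)
    balanced-fixed? w = balanced? w ×-dec fixed? w

    balanced-moved? : Decidable (λ w → Balanced w × rotate w ≢ w)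
    balanced-moved? w = balanced? w ×-dec ¬? (fixed? w)

    count-balanced : n ℕ.^ (q ∸ 1) ≡ count balanced-moved? + count balanced-fixed?
    count-balanced = begin
      n ℕ.^ (q ∸ 1)                                    ≡⟨ ∑-product≡e (q ∸ 1) ⟨
      ∑ʷ (suc (q ∸ 1)) (λ w → χ (balanced? w))         ≡⟨ cong (λ k → ∑ʷ k (λ w → χ (balanced? w))) (ℕ.m+[n∸m]≡n 0<q) ⟩
      ∑ʷ q (λ w → χ (balanced? w))                     ≡⟨ ∑ʷ-cong q (λ w _ → χ-split (balanced? w) (fixed? w)) ⟩
      ∑ʷ q (λ w → χ (balanced-fixed? w) + χ (balanced-moved? w)) ≡⟨ ∑ʷ-distrib-+ q _ _ ⟩
      count balanced-fixed? + count balanced-moved?    ≡⟨ ℕ.+-comm (count balanced-fixed?) _ ⟩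
      count balanced-moved? + count balanced-fixed?    ∎
      where open ≡-Reasoning

    count-balanced-fixed : (∀ x → x ^ q ≡ e → x ≡ e) → count balanced-fixed? ≡ 1
    count-balanced-fixed only-e = trans (∑ʷ-cong q indicator) (∑ʷ-indicator q _ (List.length-replicate q))
      where
      indicator : ∀ w → length w ≡ q → χ (balanced-fixed? w) ≡ χ (w ≟ʷ replicate q e)
      indicator []      0≡q    = contradiction 0≡q (ℕ.<⇒≢ 0<q)
      indicator (x ∷ w) |xw|≡q = χ-cong to (λ xw≡eᵠ → subst (λ v → Balanced v × rotate v ≡ v) (sym xw≡eᵠ) from) _ _
        where
        to : Balanced (x ∷ w) × rotate (x ∷ w) ≡ x ∷ w → x ∷ w ≡ replicate q e
        to (balanced , fixed) = trans xw≡xᵠ (cong (replicate q) x≡e)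
          where
          xw≡xᵠ : x ∷ w ≡ replicate q x
          xw≡xᵠ = trans (rotate-fixed⇒replicate x w fixed) (cong (λ k → replicate k x) |xw|≡q)
          x≡e : x ≡ e
          x≡e = only-e x (trans (sym (product-replicate q x)) (trans (cong product (sym xw≡xᵠ)) balanced))
        from : Balanced (replicate q e) × rotate (replicate q e) ≡ replicate q e
        from = trans (product-replicate q e) (e^ q) , rotate-replicate q e

    prime∣count-balanced-moved : q ∣ count balanced-moved?
    prime∣count-balanced-moved = prime∣count balanced-moved?
      (λ {w} |w|≡q (balanced , moved) → product-rotate w balanced , rotate-moved |w|≡q moved) (λ _ → proj₂)
      where
      rotate-moved : ∀ {w} → length w ≡ q → rotate w ≢ w → rotate (rotate w) ≢ rotate w
      rotate-moved {w} |w|≡q moved fixed =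
        moved (sym (trans (sym (rotate^-pred |w|≡q)) (iterate-fixed rotate fixed (q ∸ 1))))

    cauchy : q ∣ n → ∃ λ x → x ≢ e × x ^ q ≡ e
    cauchy q∣n with Fin.any? (λ x → ¬? (x Fin.≟ e) ×-dec (x ^ q Fin.≟ e))
    ... | yes found = found
    ... | no  none  = contradiction (∣m+n∣m⇒∣n q∣moved+1 prime∣count-balanced-moved) (prime∤1 q-prime)
      where
      only-e : ∀ x → x ^ q ≡ e → x ≡ e
      only-e x xᵠ≡e with x Fin.≟ e
      ... | yes x≡e = x≡e
      ... | no  x≢e = contradiction (x , x≢e , xᵠ≡e) none
      q∣moved+1 : q ∣ count balanced-moved? + 1
      q∣moved+1 = subst (q ∣_) (trans count-balanced (cong (count balanced-moved? +_) (count-balanced-fixed only-e)))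
                        (∣⇒∣^ q∣n (ℕ.m<n⇒0<n∸m (1<prime q-prime)))

-- Line graphs and power graphs

module LineGraphs (Γ : SimpleGraph) where
  open SimpleGraph Γ

  endpoints : Edge Γ → Fin k × Fin k
  endpoints = proj₁

  _∈ᵉ_ : Fin k → Edge Γ → Set
  x ∈ᵉ ((i , j) , _) = x ≡ i ⊎ x ≡ j

  lineAdj⇒shared-endpoint : ∀ X Y → LineAdj Γ X Y → proj₁ (endpoints X) ∈ᵉ Y ⊎ proj₂ (endpoints X) ∈ᵉ Y
  lineAdj⇒shared-endpoint ((i , j) , _) ((i′ , j′) , _) (_ , inj₁ i≡i′)               = inj₁ (inj₁ i≡i′)
  lineAdj⇒shared-endpoint ((i , j) , _) ((i′ , j′) , _) (_ , inj₂ (inj₁ i≡j′))        = inj₁ (inj₂ i≡j′)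
  lineAdj⇒shared-endpoint ((i , j) , _) ((i′ , j′) , _) (_ , inj₂ (inj₂ (inj₁ j≡i′))) = inj₂ (inj₁ j≡i′)
  lineAdj⇒shared-endpoint ((i , j) , _) ((i′ , j′) , _) (_ , inj₂ (inj₂ (inj₂ j≡j′))) = inj₂ (inj₂ j≡j′)

  shared-endpoint⇒lineAdj : ∀ {x} X Y → x ∈ᵉ X → x ∈ᵉ Y → endpoints X ≢ endpoints Y → LineAdj Γ X Y
  shared-endpoint⇒lineAdj ((i , j) , _) ((i′ , j′) , _) (inj₁ refl) (inj₁ refl) X≢Y = X≢Y , inj₁ refl
  shared-endpoint⇒lineAdj ((i , j) , _) ((i′ , j′) , _) (inj₁ refl) (inj₂ refl) X≢Y = X≢Y , inj₂ (inj₁ refl)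
  shared-endpoint⇒lineAdj ((i , j) , _) ((i′ , j′) , _) (inj₂ refl) (inj₁ refl) X≢Y = X≢Y , inj₂ (inj₂ (inj₁ refl))
  shared-endpoint⇒lineAdj ((i , j) , _) ((i′ , j′) , _) (inj₂ refl) (inj₂ refl) X≢Y = X≢Y , inj₂ (inj₂ (inj₂ refl))

  lineAdj-endpoints : ∀ X X′ Y → endpoints X ≡ endpoints X′ → LineAdj Γ X Y → LineAdj Γ X′ Y
  lineAdj-endpoints ((i , j) , _) ((.i , .j) , _) Y refl XY = XY

Distinguished : ∀ G → PPVertex G → PPVertex G → Set
Distinguished G u v = ¬ PPAdj G u v × ∃ λ d → PPAdj G u d × ¬ PPAdj G v d

module LineGraphIso {G Γ} (iso : PPIsoLine G Γ) where
  open PPIsoLine iso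
  open LineGraphs Γ

  -- Edges with equal endpoints have equal neighbourhoods in the line graph, which d rules out.
  distinguished⇒disjoint : ∀ {u v x} → Distinguished G u v → x ∈ᵉ to u → x ∈ᵉ to v → ⊥
  distinguished⇒disjoint {u} {v} (¬uv , d , ud , ¬vd) x∈u x∈v
    with Product.≡-dec Fin._≟_ Fin._≟_ (endpoints (to u)) (endpoints (to v))
  ... | yes same   = ¬vd (adj-from v d (lineAdj-endpoints (to u) (to v) (to d) same (adj-to u d ud)))
  ... | no  differ = ¬uv (adj-from u v (shared-endpoint⇒lineAdj (to u) (to v) x∈u x∈v differ))

  no-distinguished-claw : ∀ {c l₁ l₂ l₃} → PPAdj G c l₁ → PPAdj G c l₂ → PPAdj G c l₃ →
                          Distinguished G l₁ l₂ → Distinguished G l₁ l₃ → Distinguished G l₂ l₃ → ⊥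
  no-distinguished-claw {c} {l₁} {l₂} {l₃} cl₁ cl₂ cl₃ d₁₂ d₁₃ d₂₃
    with lineAdj⇒shared-endpoint (to c) (to l₁) (adj-to c l₁ cl₁) | lineAdj⇒shared-endpoint (to c) (to l₂) (adj-to c l₂ cl₂)
       | lineAdj⇒shared-endpoint (to c) (to l₃) (adj-to c l₃ cl₃)
  ... | inj₁ x∈l₁ | inj₁ x∈l₂ | _         = distinguished⇒disjoint d₁₂ x∈l₁ x∈l₂
  ... | inj₂ y∈l₁ | inj₂ y∈l₂ | _         = distinguished⇒disjoint d₁₂ y∈l₁ y∈l₂
  ... | inj₁ x∈l₁ | inj₂ _    | inj₁ x∈l₃ = distinguished⇒disjoint d₁₃ x∈l₁ x∈l₃
  ... | inj₁ _    | inj₂ y∈l₂ | inj₂ y∈l₃ = distinguished⇒disjoint d₂₃ y∈l₂ y∈l₃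
  ... | inj₂ _    | inj₁ x∈l₂ | inj₁ x∈l₃ = distinguished⇒disjoint d₂₃ x∈l₂ x∈l₃
  ... | inj₂ y∈l₁ | inj₁ _    | inj₂ y∈l₃ = distinguished⇒disjoint d₁₃ y∈l₁ y∈l₃

module PowerGraph (G : FinGroup) where
  open GroupTheory G

  PowerOf : Elt G → Elt G → Set
  PowerOf u w = ∃ λ m → 0 < m × u ^ m ≡ w

  Incomparable : Elt G → Elt G → Set
  Incomparable u w = ¬ PowerOf u w × ¬ PowerOf w u

  incomparable-sym : ∀ {u w} → Incomparable u w → Incomparable w u
  incomparable-sym (u↛w , w↛u) = w↛u , u↛w

  incomparable⇒¬adj : ∀ {u w} → Incomparable u w → ¬ PowerAdj G u w
  incomparable⇒¬adj (u↛w , w↛u) (_ , inj₁ u↠w) = u↛w u↠w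
  incomparable⇒¬adj (u↛w , w↛u) (_ , inj₂ w↠u) = w↛u w↠u

  incomparable⇒≢ : ∀ {u w} → Incomparable u w → w ≢ u
  incomparable⇒≢ {u} (u↛w , _) refl = u↛w (1 , z<s , idʳ u)

  incomparable⇒¬dominating : ∀ {u w} → Incomparable u w → ¬ Dominating G u
  incomparable⇒¬dominating u⋈w dominating = incomparable⇒¬adj u⋈w (dominating _ (incomparable⇒≢ u⋈w))

  power⇒commute : ∀ {u w} → PowerOf u w → Commute u w
  power⇒commute {u} (m , _ , refl) = commute-self-^ u m

  incomparable-by-exponents : ∀ {u w} U W → u ^ U ≡ e → w ^ U ≢ e → w ^ W ≡ e → u ^ W ≢ e → Incomparable u w
  incomparable-by-exponents {u} {w} U W uᵁ≡e wᵁ≢e wᵂ≡e uᵂ≢e =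
    (λ { (m , _ , refl) → wᵁ≢e (killed u U m uᵁ≡e) }) , (λ { (m , _ , refl) → uᵂ≢e (killed w W m wᵂ≡e) })
    where
    killed : ∀ x X m → x ^ X ≡ e → (x ^ m) ^ X ≡ e
    killed x X m xˣ≡e = trans (^-*-assoc x m X) (^-∣ X (n∣m*n m) xˣ≡e)

  incomparable-by-powers : ∀ {u w x y} → PowerOf u x → PowerOf w y → ¬ Commute x y → Incomparable u w
  incomparable-by-powers {u} {w} (i , _ , refl) (j , _ , refl) xy≢yx =
    (λ u↠w → xy≢yx (commute-^ i j (power⇒commute u↠w))) ,
    (λ w↠u → xy≢yx (sym (commute-^ j i (power⇒commute w↠u))))

module NilpotentPowerGraph (G : FinGroup) (nilpotent : Nilpotent G) where
  open GroupTheory G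
  open PowerGraph G
  open UpperCentralSeries G using (coprime-orders-commute)
  open CauchyTheorem G using (cauchy)

  NonCommutingPair : ℕ → Set
  NonCommutingPair A = ∃₂ λ a a′ → a ^ A ≡ e × a′ ^ A ≡ e × ¬ Commute a a′

  commute? : ∀ x y → Dec (Commute x y)
  commute? x y = x · y Fin.≟ y · x

  noncommuting-split : ∀ {u v} → Coprime u v → 0 < u → 0 < v →
                       NonCommutingPair (u * v) → NonCommutingPair u ⊎ NonCommutingPair v
  noncommuting-split {u} {v} u⊥v 0<u 0<v (x , y , xᵘᵛ≡e , yᵘᵛ≡e , xy≢yx)
    with coprime-decomposition u⊥v 0<u 0<v
  ... | i , j , decompose with decompose x xᵘᵛ≡e | decompose y yᵘᵛ≡e
  ...   | x≡ , xᵢᵘ≡e , xⱼᵛ≡e | y≡ , yᵢᵘ≡e , yⱼᵛ≡e with commute? (x ^ i) (y ^ i) | commute? (x ^ j) (y ^ j)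
  ...     | no xᵢyᵢ≢yᵢxᵢ   | _               = inj₁ (x ^ i , y ^ i , xᵢᵘ≡e , yᵢᵘ≡e , xᵢyᵢ≢yᵢxᵢ)
  ...     | yes _          | no xⱼyⱼ≢yⱼxⱼ    = inj₂ (x ^ j , y ^ j , xⱼᵛ≡e , yⱼᵛ≡e , xⱼyⱼ≢yⱼxⱼ)
  ...     | yes xᵢyᵢ≡yᵢxᵢ  | yes xⱼyⱼ≡yⱼxⱼ   = contradiction xy≡yx xy≢yx
    where
    xᵢyⱼ≡yⱼxᵢ : Commute (x ^ i) (y ^ j)
    xᵢyⱼ≡yⱼxᵢ = coprime-orders-commute nilpotent u⊥v 0<u 0<v xᵢᵘ≡e yⱼᵛ≡e
    xⱼyᵢ≡yᵢxⱼ : Commute (x ^ j) (y ^ i)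
    xⱼyᵢ≡yᵢxⱼ = coprime-orders-commute nilpotent (Coprimality.sym u⊥v) 0<v 0<u xⱼᵛ≡e yᵢᵘ≡e
    xy≡yx : Commute x y
    xy≡yx = subst₂ Commute (sym x≡) (sym y≡) (commute-· xᵢyᵢ≡yᵢxᵢ xᵢyⱼ≡yⱼxᵢ xⱼyᵢ≡yᵢxⱼ xⱼyⱼ≡yⱼxⱼ)

  module Claw {A s t} (s-prime : Prime s) (t-prime : Prime t) (s≢t : s ≢ t) (0<A : 0 < A)
              (s∤A : ¬ s ∣ A) (t∤A : ¬ t ∣ A)
              {b c} (b≢e : b ≢ e) (bˢ≡e : b ^ s ≡ e) (c≢e : c ≢ e) (cᵗ≡e : c ^ t ≡ e) where

    0<s : 0 < s
    0<s = 0<prime s-prime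
    0<t : 0 < t
    0<t = 0<prime t-prime
    0<As : 0 < A * s
    0<As = ℕ.*-mono-≤ 0<A 0<s
    0<ts : 0 < t * s
    0<ts = ℕ.*-mono-≤ 0<t 0<s

    A⊥s : Coprime A s
    A⊥s = prime∤⇒coprime s-prime s∤A
    t⊥s : Coprime t s
    t⊥s = prime∤⇒coprime s-prime (prime∤prime s-prime t-prime s≢t)
    t⊥As : Coprime t (A * s)
    t⊥As = Coprimality.sym (prime∤⇒coprime t-prime (prime∤* t-prime t∤A (prime∤prime t-prime s-prime (s≢t ∘ sym))))
    A⊥ts : Coprime A (t * s)
    A⊥ts = Coprimality.sym (coprime-*ˡ (Coprimality.sym (prime∤⇒coprime t-prime t∤A)) (Coprimality.sym A⊥s))

    cb≡bc : Commute c b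
    cb≡bc = coprime-orders-commute nilpotent t⊥s 0<t 0<s cᵗ≡e bˢ≡e

    cb^As≢e : (c · b) ^ (A * s) ≢ e
    cb^As≢e cb^As≡e = coprime-power≢e c≢e t⊥As 0<t 0<As cᵗ≡e
      (trans (sym (^-absorbʳ (A * s) cb≡bc (^-∣ s (n∣m*n A) bˢ≡e))) cb^As≡e)

    cb^ts≡e : (c · b) ^ (t * s) ≡ e
    cb^ts≡e = trans (^-absorbʳ (t * s) cb≡bc (^-∣ s (n∣m*n t) bˢ≡e)) (^-∣ t (m∣m*n s) cᵗ≡e)

    b~cb : PowerAdj G b (c · b)
    b~cb = (λ b≡cb → c≢e (identityˡ-unique c b (sym b≡cb))) ,
           inj₂ (power-of-product t⊥s 0<t 0<s cb≡bc cᵗ≡e bˢ≡e)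

    module Leaf {x} (xᴬ≡e : x ^ A ≡ e) (x≢e : x ≢ e) where

      xb≡bx : Commute x b
      xb≡bx = coprime-orders-commute nilpotent A⊥s 0<A 0<s xᴬ≡e bˢ≡e

      b∈⟨xb⟩ : PowerOf (x · b) b
      b∈⟨xb⟩ = power-of-product A⊥s 0<A 0<s xb≡bx xᴬ≡e bˢ≡e

      x∈⟨xb⟩ : PowerOf (x · b) x
      x∈⟨xb⟩ with power-of-product (Coprimality.sym A⊥s) 0<s 0<A (sym xb≡bx) bˢ≡e xᴬ≡e
      ... | k , 0<k , bxᵏ≡x = k , 0<k , trans (cong (_^ k) xb≡bx) bxᵏ≡x

      x^As≡e : x ^ (A * s) ≡ e
      x^As≡e = ^-∣ A (m∣m*n s) xᴬ≡e

      x^ts≢e : x ^ (t * s) ≢ e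
      x^ts≢e = coprime-power≢e x≢e A⊥ts 0<A 0<ts xᴬ≡e

      b⋈x : Incomparable b x
      b⋈x = incomparable-by-exponents s A bˢ≡e
        (coprime-power≢e x≢e A⊥s 0<A 0<s xᴬ≡e) xᴬ≡e
        (coprime-power≢e b≢e (Coprimality.sym A⊥s) 0<s 0<A bˢ≡e)

      xb⋈cb : Incomparable (x · b) (c · b)
      xb⋈cb = incomparable-by-exponents (A * s) (t * s)
        (trans (^-absorbʳ (A * s) xb≡bx (^-∣ s (n∣m*n A) bˢ≡e)) x^As≡e) cb^As≢e cb^ts≡e
        (λ xb^ts≡e → x^ts≢e (trans (sym (^-absorbʳ (t * s) xb≡bx (^-∣ s (n∣m*n t) bˢ≡e))) xb^ts≡e))

      x⋈cb : Incomparable x (c · b)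
      x⋈cb = incomparable-by-exponents (A * s) (t * s) x^As≡e cb^As≢e cb^ts≡e x^ts≢e

      b~xb : PowerAdj G b (x · b)
      b~xb = (λ b≡xb → x≢e (identityˡ-unique x b (sym b≡xb))) , inj₂ b∈⟨xb⟩

      xb~x : PowerAdj G (x · b) x
      xb~x = (λ xb≡x → b≢e (identityʳ-unique x b xb≡x)) , inj₁ x∈⟨xb⟩

    no-claw : NonCommutingPair A → ∀ Γ → ¬ PPIsoLine G Γ
    no-claw (a , a′ , aᴬ≡e , a′ᴬ≡e , aa′≢a′a) Γ iso =
      no-distinguished-claw {c = vb} {l₁ = vab} {l₂ = va′b} {l₃ = vcb} La.b~xb La′.b~xb b~cb
        (incomparable⇒¬adj ab⋈a′b , va , La.xb~x , incomparable⇒¬adj (incomparable-sym a⋈a′b))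
        (incomparable⇒¬adj La.xb⋈cb , va , La.xb~x , incomparable⇒¬adj (incomparable-sym La.x⋈cb))
        (incomparable⇒¬adj La′.xb⋈cb , va′ , La′.xb~x , incomparable⇒¬adj (incomparable-sym La′.x⋈cb))
      where
      open LineGraphIso iso
      a≢e : a ≢ e
      a≢e refl = aa′≢a′a (trans (idˡ a′) (sym (idʳ a′)))
      a′≢e : a′ ≢ e
      a′≢e refl = aa′≢a′a (trans (idʳ a) (sym (idˡ a)))
      module La  = Leaf aᴬ≡e a≢e
      module La′ = Leaf a′ᴬ≡e a′≢e
      a⋈a′b : Incomparable a (a′ · b)
      a⋈a′b = incomparable-by-powers (1 , z<s , idʳ a) La′.x∈⟨xb⟩ aa′≢a′a
      ab⋈a′b : Incomparable (a · b) (a′ · b)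
      ab⋈a′b = incomparable-by-powers La.x∈⟨xb⟩ La′.x∈⟨xb⟩ aa′≢a′a
      vertex : ∀ u {w} → Incomparable u w → PPVertex G
      vertex u u⋈w = u , incomparable⇒¬dominating u⋈w
      vb va va′ vab va′b vcb : PPVertex G
      vb   = vertex b La.b⋈x
      va   = vertex a (incomparable-sym La.b⋈x)
      va′  = vertex a′ (incomparable-sym La′.b⋈x)
      vab  = vertex (a · b) La.xb⋈cb
      va′b = vertex (a′ · b) La′.xb⋈cb
      vcb  = vertex (c · b) (incomparable-sym La.xb⋈cb)

  noncommuting-pair : NonAbelian G → ∃ λ M → 0 < M × NonCommutingPair M
  noncommuting-pair nonabelian with Fin.any? (λ x → Fin.any? (λ y → ¬? (commute? x y)))
  ... | no  all-commute = contradiction commutative nonabelian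
    where
    commutative : ∀ x y → Commute x y
    commutative x y with commute? x y
    ... | yes xy≡yx = xy≡yx
    ... | no  xy≢yx = contradiction (x , y , xy≢yx) all-commute
  ... | yes (x , y , xy≢yx) with finite-order x | finite-order y
  ...   | k , 0<k , xᵏ≡e | l , 0<l , yˡ≡e =
    k * l , ℕ.*-mono-≤ 0<k 0<l , x , y , ^-∣ k (m∣m*n l) xᵏ≡e , ^-∣ l (n∣m*n k) yˡ≡e , xy≢yx

  avoid-prime : ∀ {p M} → Prime p → 0 < M → NonCommutingPair M →
                (∃ λ i → NonCommutingPair (p ℕ.^ i)) ⊎ (∃ λ w → 0 < w × w ∣ M × ¬ p ∣ w × NonCommutingPair w)
  avoid-prime {p} {M} p-prime 0<M pair with factor-out-prime p-prime M 0<M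
  ... | i , w , refl , p∤w = Sum.map (i ,_) (λ pairʷ → w , 0<w , n∣m*n (p ℕ.^ i) , p∤w , pairʷ)
                                     (noncommuting-split pⁱ⊥w (0<prime^ p-prime i) 0<w pair)
    where
    0<w : 0 < w
    0<w = *-positiveʳ (p ℕ.^ i) 0<M
    pⁱ⊥w : Coprime (p ℕ.^ i) w
    pⁱ⊥w = coprime-^ˡ (Coprimality.sym (prime∤⇒coprime p-prime p∤w)) i

  no-line-graph : ∀ {s t A} → Prime s → Prime t → s ≢ t → s ∣ n → t ∣ n → 0 < A → ¬ s ∣ A → ¬ t ∣ A →
                  NonCommutingPair A → ∀ Γ → ¬ PPIsoLine G Γ
  no-line-graph s-prime t-prime s≢t s∣n t∣n 0<A s∤A t∤A pair with cauchy s-prime s∣n | cauchy t-prime t∣n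
  ... | b , b≢e , bˢ≡e | c , c≢e , cᵗ≡e = Claw.no-claw s-prime t-prime s≢t 0<A s∤A t∤A b≢e bˢ≡e c≢e cᵗ≡e pair

mainTheorem15 : (G : FinGroup) → Nilpotent G → NonAbelian G →
    AtLeastThreePrimeDivisors (order G) →
    (Γ : SimpleGraph) → ¬ PPIsoLine G Γ
mainTheorem15 G nilpotent nonabelian (p , q , r , p-prime , q-prime , r-prime , p≢q , q≢r , p≢r , p∣n , q∣n , r∣n) =
  refute (noncommuting-pair nonabelian)
  where
  open NilpotentPowerGraph G nilpotent
  refute : (∃ λ M → 0 < M × NonCommutingPair M) → ∀ Γ → ¬ PPIsoLine G Γ
  refute (M , 0<M , pairᴹ) with avoid-prime p-prime 0<M pairᴹ
  ... | inj₁ (i , pairⁱ) = no-line-graph q-prime r-prime q≢r q∣n r∣n (0<prime^ p-prime i)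
    (prime∤prime^ q-prime p-prime (p≢q ∘ sym) i) (prime∤prime^ r-prime p-prime (p≢r ∘ sym) i) pairⁱ
  ... | inj₂ (w , 0<w , _ , p∤w , pairʷ) with avoid-prime q-prime 0<w pairʷ
  ...   | inj₁ (j , pairʲ) = no-line-graph p-prime r-prime p≢r p∣n r∣n (0<prime^ q-prime j)
    (prime∤prime^ p-prime q-prime p≢q j) (prime∤prime^ r-prime q-prime (q≢r ∘ sym) j) pairʲ
  ...   | inj₂ (v , 0<v , v∣w , q∤v , pairᵛ) =
    no-line-graph p-prime q-prime p≢q p∣n q∣n 0<v (λ p∣v → p∤w (∣-trans p∣v v∣w)) q∤v pairᵛ
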